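{- There is a function $f:\mathbb{N}\to\mathbb{R}$ with $f(n)\to0$ as $n\to\infty$ such that for every positive integer $n$ there exist nonempty $A,B,C\subseteq\mathbb{Z}_n$ with $$\mathbb{E}_{a'\in A,\,b'\in B}\big[\#\{(a,b,c)\in A\times B\times C: 0=a'+b+c=a+b'+c\}\big]\le1$$ (the expectation over uniformly random $a'\in A$, $b'\in B$) and such that the number of $(a,b,c)\in A\times B\times C$ with $a+b+c=0$ in $\mathbb{Z}_n$ is at least $n^{3/2-f(n)}$. -}

module Defs where

open import Data.Bool using (Bool; true; false; if_then_else_)
open import Data.Nat using (ℕ; zero; suc; _+_; _*_; _^_; _≤_)
open import Data.Nat.DivMod using (_mod_)
open import Data.Fin using (Fin; toℕ) renaming (zero to fzero; suc to fsuc)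
import Data.Fin as F
open import Data.Fin.Subset using (Subset)
open import Data.Vec using (lookup)
open import Data.Integer using (ℤ; +_; -[1+_])
open import Data.Rational using (ℚ; ↥_; ↧ₙ_)
open import Relation.Nullary using (does)

sumFin : (n : ℕ) → (Fin n → ℕ) → ℕ
sumFin zero    f = 0
sumFin (suc n) f = f fzero + sumFin n (λ i → f (fsuc i))

𝟙 : Bool → ℕ
𝟙 true  = 1
𝟙 false = 0

mem : ∀ {n} → Subset n → Fin n → ℕ
mem A x = 𝟙 (lookup A x)

eqInd : ∀ {n} → Fin n → Fin n → ℕ
eqInd x y = 𝟙 (does (x F.≟ y))

_+ₙ_ : ∀ {m} → Fin (suc m) → Fin (suc m) → Fin (suc m)
_+ₙ_ {m} a b = (toℕ a + toℕ b) mod (suc m)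
infixl 6 _+ₙ_

triangles : ∀ {m} → (A B C : Subset (suc m)) → ℕ
triangles {m} A B C =
  sumFin (suc m) λ a → sumFin (suc m) λ b → sumFin (suc m) λ c →
    mem A a * mem B b * mem C c * eqInd (a +ₙ b +ₙ c) fzero

-- Σ_{a'∈A, b'∈B} #{(a,b,c) ∈ A×B×C : 0 = a'+b+c = a+b'+c}
-- (|A|·|B| times the expectation in the paper)
pairSum : ∀ {m} → (A B C : Subset (suc m)) → ℕ
pairSum {m} A B C =
  sumFin (suc m) λ a' → sumFin (suc m) λ b' →
    mem A a' * mem B b' *
    (sumFin (suc m) λ a → sumFin (suc m) λ b → sumFin (suc m) λ c →
       mem A a * mem B b * mem C c
       * eqInd (a' +ₙ b +ₙ c) fzero * eqInd (a +ₙ b' +ₙ c) fzero)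

-- powLe n e T  means  n ^ e ≤ T  (real exponent e ∈ ℚ, n ≥ 1, T ∈ ℕ).
-- With e = p/q (q > 0): n^(p/q) ≤ T  ⇔  n^p ≤ T^q  (q-th power is monotone on
-- nonnegative reals); for p = -(k+1) this reads 1 ≤ T^q · n^(k+1).
powLe : ℕ → ℚ → ℕ → Set
powLe n e T with ↥ e
... | + k      = n ^ k ≤ T ^ (↧ₙ e)
... | -[1+ k ] = 1 ≤ T ^ (↧ₙ e) * n ^ (suc k)

-- Encode pairs of vectors in [d]ᵏ as three-digit numbers in base (2d)ᵏ, each digit itself a
-- base-2d numeral, so that adding two encodings never carries. A = B consists of the numbers
-- with digits (u, x, 1 + ‖x‖²) and −C of those with digits (w, 2z, 2 + 2‖z‖²), for u, x, z ∈ [d]ᵏ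
-- and w ∈ [2d]ᵏ; for n large enough no reduction mod n occurs. Then a + b + c = 0 says u + v = w,
-- x + y = 2z and ‖x‖² + ‖y‖² = 2‖z‖², and the parallelogram law forces x = y = z. So every
-- (u, v, x) gives exactly one solution, (dᵏ)³ in all, while |A| = (dᵏ)². In a pair of solutions
-- a′ + b + c = 0 = a + b′ + c the elements a′, b, b′ determine c and a, and b, b′ must share the
-- second coordinate of a′, so there are at most |A|² such pairs. With d = 2^(3t+3) and k as large
-- as n allows, n ≤ 2^O(tk) and (dᵏ)³ ≥ n^(3/2 − 1/(t+1)) once k ≥ 12t + 12; the loss f(n) is
-- 1/(t+1) for the largest t admissible at n, which tends to infinity with n.

module Submission where

module Sums where

  open import Defs using (𝟙; sumFin; mem; eqInd)
  open import Data.Bool using (true; false)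
  open import Data.Nat using (ℕ; zero; suc; _+_; _*_; _≤_; z≤n; _≟_)
  open import Data.Nat.Properties
  open import Data.Fin using (Fin) renaming (zero to fzero; suc to fsuc)
  open import Data.Fin.Subset using (Subset; ∣_∣)
  open import Data.Vec using ([]; _∷_)
  open import Data.List using (List; []; _∷_; map; _++_; cartesianProductWith; length)
  open import Data.List.Membership.Propositional using (_∈_)
  open import Data.List.Relation.Unary.Any using (here; there)
  open import Data.List.Relation.Unary.All using (All; []; _∷_)
  import Data.List.Relation.Unary.All as All
  open import Data.List.Relation.Unary.AllPairs using (_∷_)
  open import Data.List.Relation.Unary.Unique.Propositional using (Unique)
  open import Data.Product using (∃; _×_; _,_)
  open import Relation.Nullary using (does; yes; no; contradiction)
  open import Relation.Nullary.Decidable using (dec-true; dec-false)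
  open import Relation.Binary.PropositionalEquality
  open import Algebra.Properties.CommutativeSemigroup +-commutativeSemigroup using (interchange)

  δ : ℕ → ℕ → ℕ
  δ i j = 𝟙 (does (i ≟ j))

  δ-refl : ∀ i → δ i i ≡ 1
  δ-refl i = cong 𝟙 (dec-true (i ≟ i) refl)

  δ≤1 : ∀ i j → δ i j ≤ 1
  δ≤1 i j = 𝟙≤1 (does (i ≟ j))
    where
    𝟙≤1 : ∀ b → 𝟙 b ≤ 1
    𝟙≤1 true  = ≤-refl
    𝟙≤1 false = z≤n

  δ≢0⇒≡ : ∀ {i j} → δ i j ≢ 0 → i ≡ j
  δ≢0⇒≡ {i} {j} δ≢0 with i ≟ j
  ... | yes i≡j = i≡j
  ... | no  i≢j = contradiction (cong 𝟙 (dec-false (i ≟ j) i≢j)) δ≢0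

  *≢0⇒≢0 : ∀ m n → m * n ≢ 0 → m ≢ 0 × n ≢ 0
  *≢0⇒≢0 m n mn≢0 =
    (λ m≡0 → mn≢0 (cong (_* n) m≡0)) , (λ n≡0 → mn≢0 (trans (cong (m *_) n≡0) (*-zeroʳ m)))

  ∑ : ∀ {A : Set} → List A → (A → ℕ) → ℕ
  ∑ []      g = 0
  ∑ (x ∷ l) g = g x + ∑ l g

  syntax ∑ l (λ x → e) = ∑[ x ∈ l ] e

  module _ {A : Set} where

    ∑-cong : ∀ (l : List A) {f g : A → ℕ} → (∀ x → f x ≡ g x) → ∑ l f ≡ ∑ l g
    ∑-cong []      f≡g = refl
    ∑-cong (x ∷ l) f≡g = cong₂ _+_ (f≡g x) (∑-cong l f≡g)

    ∑-mono-≤ : ∀ (l : List A) {f g : A → ℕ} → (∀ x → f x ≤ g x) → ∑ l f ≤ ∑ l g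
    ∑-mono-≤ []      f≤g = z≤n
    ∑-mono-≤ (x ∷ l) f≤g = +-mono-≤ (f≤g x) (∑-mono-≤ l f≤g)

    ∑-++ : ∀ (l l′ : List A) g → ∑ (l ++ l′) g ≡ ∑ l g + ∑ l′ g
    ∑-++ []      l′ g = refl
    ∑-++ (x ∷ l) l′ g = trans (cong (g x +_) (∑-++ l l′ g)) (sym (+-assoc (g x) _ _))

    ∑-+ : ∀ (l : List A) f g → ∑[ x ∈ l ] (f x + g x) ≡ ∑ l f + ∑ l g
    ∑-+ []      f g = refl
    ∑-+ (x ∷ l) f g =
      trans (cong (f x + g x +_) (∑-+ l f g)) (interchange (f x) (g x) (∑ l f) (∑ l g))

    ∑-*ˡ : ∀ (l : List A) c f → ∑[ x ∈ l ] (c * f x) ≡ c * ∑ l f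
    ∑-*ˡ []      c f = sym (*-zeroʳ c)
    ∑-*ˡ (x ∷ l) c f = trans (cong (c * f x +_) (∑-*ˡ l c f)) (sym (*-distribˡ-+ c (f x) _))

    ∑-const : ∀ (l : List A) c → ∑[ _ ∈ l ] c ≡ length l * c
    ∑-const []      c = refl
    ∑-const (x ∷ l) c = cong (c +_) (∑-const l c)

    ∈⇒≤∑ : ∀ {l : List A} {x} g → x ∈ l → g x ≤ ∑ l g
    ∈⇒≤∑ {y ∷ l} g (here refl) = m≤m+n (g y) _
    ∈⇒≤∑ {y ∷ l} g (there x∈l) = ≤-trans (∈⇒≤∑ g x∈l) (m≤n+m _ (g y))

    ∑≢0⇒∃ : ∀ (l : List A) g → ∑ l g ≢ 0 → ∃ λ x → g x ≢ 0
    ∑≢0⇒∃ []      g ∑≢0 = contradiction refl ∑≢0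
    ∑≢0⇒∃ (x ∷ l) g ∑≢0 with g x ≟ 0
    ... | yes gx≡0 = ∑≢0⇒∃ l g (λ ∑≡0 → ∑≢0 (cong₂ _+_ gx≡0 ∑≡0))
    ... | no  gx≢0 = x , gx≢0

    ∑-vanishing : ∀ (l : List A) {g} → All (λ x → g x ≡ 0) l → ∑ l g ≡ 0
    ∑-vanishing []      []              = refl
    ∑-vanishing (x ∷ l) (gx≡0 ∷ rest) = cong₂ _+_ gx≡0 (∑-vanishing l rest)

    ∑≤-atMostOne : ∀ (l : List A) g c → Unique l →
      (∀ x y → g x ≢ 0 → g y ≢ 0 → x ≡ y) → (∀ x → g x ≤ c) → ∑ l g ≤ c
    ∑≤-atMostOne []      g c _           _   _   = z≤n
    ∑≤-atMostOne (x ∷ l) g c (x∉l ∷ ul) one g≤c with g x ≟ 0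
    ... | yes gx≡0 = subst (_≤ c) (cong (_+ ∑ l g) (sym gx≡0)) (∑≤-atMostOne l g c ul one g≤c)
    ... | no  gx≢0 = subst (_≤ c) (sym (trans (cong (g x +_) rest≡0) (+-identityʳ _))) (g≤c x)
      where
      vanish : ∀ {y} → x ≢ y → g y ≡ 0
      vanish {y} x≢y with g y ≟ 0
      ... | yes gy≡0 = gy≡0
      ... | no  gy≢0 = contradiction (one x y gx≢0 gy≢0) x≢y
      rest≡0 : ∑ l g ≡ 0
      rest≡0 = ∑-vanishing l (All.map vanish x∉l)

  module _ {A B : Set} where

    ∑-map : ∀ (f : A → B) (l : List A) g → ∑ (map f l) g ≡ ∑[ x ∈ l ] g (f x)
    ∑-map f []      g = refl
    ∑-map f (x ∷ l) g = cong (g (f x) +_) (∑-map f l g)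

    ∑-comm : ∀ (l : List A) (l′ : List B) (f : A → B → ℕ) →
      ∑[ x ∈ l ] ∑[ y ∈ l′ ] f x y ≡ ∑[ y ∈ l′ ] ∑[ x ∈ l ] f x y
    ∑-comm []      l′ f = sym (∑-vanishing l′ {λ _ → 0} (All.universal (λ _ → refl) l′))
    ∑-comm (x ∷ l) l′ f =
      trans (cong (∑ l′ (f x) +_) (∑-comm l l′ f)) (sym (∑-+ l′ (f x) (λ y → ∑[ x ∈ l ] f x y)))

  ∑-cartesianProductWith : ∀ {A B C : Set} (f : A → B → C) l l′ g →
    ∑ (cartesianProductWith f l l′) g ≡ ∑[ x ∈ l ] ∑[ y ∈ l′ ] g (f x y)
  ∑-cartesianProductWith f []      l′ g = refl
  ∑-cartesianProductWith f (x ∷ l) l′ g =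
    trans (∑-++ (map (f x) l′) _ g) (cong₂ _+_ (∑-map (f x) l′ g) (∑-cartesianProductWith f l l′ g))

  sumFin-cong : ∀ n {f g : Fin n → ℕ} → (∀ i → f i ≡ g i) → sumFin n f ≡ sumFin n g
  sumFin-cong zero    f≡g = refl
  sumFin-cong (suc n) f≡g = cong₂ _+_ (f≡g fzero) (sumFin-cong n (λ i → f≡g (fsuc i)))

  sumFin-*ˡ : ∀ n c (f : Fin n → ℕ) → sumFin n (λ i → c * f i) ≡ c * sumFin n f
  sumFin-*ˡ zero    c f = sym (*-zeroʳ c)
  sumFin-*ˡ (suc n) c f =
    trans (cong (c * f fzero +_) (sumFin-*ˡ n c _)) (sym (*-distribˡ-+ c (f fzero) _))

  sumFin-+ : ∀ n (f g : Fin n → ℕ) → sumFin n (λ i → f i + g i) ≡ sumFin n f + sumFin n g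
  sumFin-+ zero    f g = refl
  sumFin-+ (suc n) f g =
    trans (cong (f fzero + g fzero +_) (sumFin-+ n _ _)) (interchange (f fzero) (g fzero) _ _)

  sumFin-zero : ∀ n → sumFin n (λ _ → 0) ≡ 0
  sumFin-zero zero    = refl
  sumFin-zero (suc n) = sumFin-zero n

  sumFin-eqInd : ∀ n (x : Fin n) g → sumFin n (λ i → eqInd i x * g i) ≡ g x
  sumFin-eqInd (suc n) fzero    g =
    trans (cong (g fzero + 0 +_) (sumFin-zero n)) (trans (+-identityʳ _) (+-identityʳ _))
  sumFin-eqInd (suc n) (fsuc x) g = sumFin-eqInd n x (λ i → g (fsuc i))

  card≡sumFin : ∀ n (p : Subset n) → ∣ p ∣ ≡ sumFin n (mem p)
  card≡sumFin zero    []          = refl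
  card≡sumFin (suc n) (true  ∷ p) = cong suc (card≡sumFin n p)
  card≡sumFin (suc n) (false ∷ p) = card≡sumFin n p

module ListSubsets where

  open Sums
  open import Defs using (𝟙; sumFin; mem; eqInd; _+ₙ_; triangles; pairSum)
  open import Data.Bool using (false; _∨_)
  open import Data.Nat using (ℕ; suc; _+_; _*_)
  open import Data.Nat.Properties
  open import Data.Fin using (Fin) renaming (zero to fzero)
  import Data.Fin.Properties as Fin
  open import Data.Fin.Subset using (Subset; Nonempty; ∣_∣)
  open import Data.Vec using (tabulate)
  open import Data.Vec.Properties using (lookup∘tabulate; lookup⇒[]=)
  open import Data.List using (List; []; _∷_)
  open import Data.List.Membership.Propositional using (_∈_; _∉_)
  open import Data.List.Relation.Unary.Any using (any?)
  open import Data.List.Relation.Unary.All.Properties using (All¬⇒¬Any)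
  open import Data.List.Relation.Unary.AllPairs using (_∷_)
  open import Data.List.Relation.Unary.Unique.Propositional using (Unique)
  open import Data.Product using (_,_)
  open import Relation.Nullary using (Dec; does; yes; no)
  open import Relation.Nullary.Decidable using (dec-true; dec-false)
  open import Relation.Binary.PropositionalEquality

  subsetOf : ∀ {n} → List (Fin n) → Subset n
  subsetOf l = tabulate (λ i → does (any? (i Fin.≟_) l))

  mem-subsetOf : ∀ {n} (l : List (Fin n)) i → mem (subsetOf l) i ≡ 𝟙 (does (any? (i Fin.≟_) l))
  mem-subsetOf l i = cong 𝟙 (lookup∘tabulate _ i)

  mem-subsetOf-∷ : ∀ {n} {x : Fin n} {l} → x ∉ l → ∀ i →
    mem (subsetOf (x ∷ l)) i ≡ eqInd i x + mem (subsetOf l) i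
  mem-subsetOf-∷ {x = x} {l} x∉l i = begin
    mem (subsetOf (x ∷ l)) i                          ≡⟨ mem-subsetOf (x ∷ l) i ⟩
    𝟙 (does (i Fin.≟ x) ∨ does (any? (i Fin.≟_) l))   ≡⟨ 𝟙-∨ (i Fin.≟ x) _ exclusive ⟩
    eqInd i x + 𝟙 (does (any? (i Fin.≟_) l))          ≡⟨ cong (eqInd i x +_) (mem-subsetOf l i) ⟨
    eqInd i x + mem (subsetOf l) i                    ∎
    where
    open ≡-Reasoning
    𝟙-∨ : ∀ {P : Set} (p? : Dec P) b → (P → b ≡ false) → 𝟙 (does p? ∨ b) ≡ 𝟙 (does p?) + 𝟙 b
    𝟙-∨ (yes p) b b≡false = cong (λ c → 1 + 𝟙 c) (sym (b≡false p))
    𝟙-∨ (no _)  b _       = refl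
    exclusive : i ≡ x → does (any? (i Fin.≟_) l) ≡ false
    exclusive i≡x = dec-false (any? (i Fin.≟_) l) (λ i∈l → x∉l (subst (_∈ l) i≡x i∈l))

  sumFin-subsetOf : ∀ {n} (l : List (Fin n)) → Unique l → ∀ g →
    sumFin n (λ i → mem (subsetOf l) i * g i) ≡ ∑ l g
  sumFin-subsetOf {n} []      _           g =
    trans (sumFin-cong n (λ i → cong (λ b → 𝟙 b * g i) (lookup∘tabulate _ i))) (sumFin-zero n)
  sumFin-subsetOf {n} (x ∷ l) (x∉l ∷ ul) g = begin
    sumFin n (λ i → mem (subsetOf (x ∷ l)) i * g i)
      ≡⟨ sumFin-cong n (λ i → trans (cong (_* g i) (mem-subsetOf-∷ (All¬⇒¬Any x∉l) i))
                                     (*-distribʳ-+ (g i) (eqInd i x) (mem (subsetOf l) i))) ⟩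
    sumFin n (λ i → eqInd i x * g i + mem (subsetOf l) i * g i)
      ≡⟨ sumFin-+ n _ _ ⟩
    sumFin n (λ i → eqInd i x * g i) + sumFin n (λ i → mem (subsetOf l) i * g i)
      ≡⟨ cong₂ _+_ (sumFin-eqInd n x g) (sumFin-subsetOf l ul g) ⟩
    g x + ∑ l g ∎
    where open ≡-Reasoning

  module _ {n} {LA LB : List (Fin n)} (uA : Unique LA) (uB : Unique LB) where

    sumFin²-subsetOf : ∀ (H : Fin n → Fin n → ℕ) →
      sumFin n (λ a → sumFin n (λ b → mem (subsetOf LA) a * mem (subsetOf LB) b * H a b))
        ≡ ∑[ a ∈ LA ] ∑[ b ∈ LB ] H a b
    sumFin²-subsetOf H = begin
      sumFin n (λ a → sumFin n (λ b → mem A a * mem B b * H a b))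
        ≡⟨ sumFin-cong n (λ a → sumFin-cong n (λ b → *-assoc (mem A a) (mem B b) (H a b))) ⟩
      sumFin n (λ a → sumFin n (λ b → mem A a * (mem B b * H a b)))
        ≡⟨ sumFin-cong n (λ a → trans (sumFin-*ˡ n (mem A a) (λ b → mem B b * H a b))
                                       (cong (mem A a *_) (sumFin-subsetOf LB uB (H a)))) ⟩
      sumFin n (λ a → mem A a * ∑ LB (H a))
        ≡⟨ sumFin-subsetOf LA uA (λ a → ∑ LB (H a)) ⟩
      ∑[ a ∈ LA ] ∑[ b ∈ LB ] H a b ∎
      where
      open ≡-Reasoning
      A B : Subset n
      A = subsetOf LA
      B = subsetOf LB

    sumFin³-subsetOf : ∀ {LC : List (Fin n)} → Unique LC → ∀ (G : Fin n → Fin n → Fin n → ℕ) →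
      sumFin n (λ a → sumFin n (λ b → sumFin n (λ c →
        mem (subsetOf LA) a * mem (subsetOf LB) b * mem (subsetOf LC) c * G a b c)))
        ≡ ∑[ a ∈ LA ] ∑[ b ∈ LB ] ∑[ c ∈ LC ] G a b c
    sumFin³-subsetOf {LC} uC G = trans
      (sumFin-cong n (λ a → sumFin-cong n (λ b → begin
        sumFin n (λ c → mem A a * mem B b * mem C c * G a b c)
          ≡⟨ sumFin-cong n (λ c → *-assoc (mem A a * mem B b) (mem C c) (G a b c)) ⟩
        sumFin n (λ c → mem A a * mem B b * (mem C c * G a b c))
          ≡⟨ sumFin-*ˡ n (mem A a * mem B b) (λ c → mem C c * G a b c) ⟩
        mem A a * mem B b * sumFin n (λ c → mem C c * G a b c)
          ≡⟨ cong (mem A a * mem B b *_) (sumFin-subsetOf LC uC (G a b)) ⟩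
        mem A a * mem B b * ∑ LC (G a b) ∎)))
      (sumFin²-subsetOf (λ a b → ∑ LC (G a b)))
      where
      open ≡-Reasoning
      A B C : Subset n
      A = subsetOf LA
      B = subsetOf LB
      C = subsetOf LC

    sumFin-pairSum-subsetOf : ∀ {LC : List (Fin n)} → Unique LC →
      ∀ (G H : Fin n → Fin n → Fin n → ℕ) →
      sumFin n (λ a′ → sumFin n (λ b′ → mem (subsetOf LA) a′ * mem (subsetOf LB) b′ *
        sumFin n (λ a → sumFin n (λ b → sumFin n (λ c →
          mem (subsetOf LA) a * mem (subsetOf LB) b * mem (subsetOf LC) c * G a′ b c * H a b′ c)))))
        ≡ ∑[ a′ ∈ LA ] ∑[ b′ ∈ LB ] ∑[ a ∈ LA ] ∑[ b ∈ LB ] ∑[ c ∈ LC ] (G a′ b c * H a b′ c)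
    sumFin-pairSum-subsetOf {LC} uC G H = trans
      (sumFin²-subsetOf (λ a′ b′ → sumFin n (λ a → sumFin n (λ b → sumFin n (λ c →
        mem A a * mem B b * mem C c * G a′ b c * H a b′ c)))))
      (∑-cong LA (λ a′ → ∑-cong LB (λ b′ → trans
        (sumFin-cong n (λ a → sumFin-cong n (λ b → sumFin-cong n (λ c →
          *-assoc (mem A a * mem B b * mem C c) (G a′ b c) (H a b′ c)))))
        (sumFin³-subsetOf uC (λ a b c → G a′ b c * H a b′ c)))))
      where
      A B C : Subset n
      A = subsetOf LA
      B = subsetOf LB
      C = subsetOf LC

  module _ {m} {LA LB LC : List (Fin (suc m))} (uA : Unique LA) (uB : Unique LB) (uC : Unique LC)
    where

    triangles-subsetOf : triangles (subsetOf LA) (subsetOf LB) (subsetOf LC)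
      ≡ ∑[ a ∈ LA ] ∑[ b ∈ LB ] ∑[ c ∈ LC ] eqInd (a +ₙ b +ₙ c) fzero
    triangles-subsetOf = sumFin³-subsetOf uA uB uC (λ a b c → eqInd (a +ₙ b +ₙ c) fzero)

    pairSum-subsetOf : pairSum (subsetOf LA) (subsetOf LB) (subsetOf LC)
      ≡ ∑[ a′ ∈ LA ] ∑[ b′ ∈ LB ] ∑[ a ∈ LA ] ∑[ b ∈ LB ] ∑[ c ∈ LC ]
          (eqInd (a′ +ₙ b +ₙ c) fzero * eqInd (a +ₙ b′ +ₙ c) fzero)
    pairSum-subsetOf = sumFin-pairSum-subsetOf uA uB uC
      (λ a′ b c → eqInd (a′ +ₙ b +ₙ c) fzero) (λ a b′ c → eqInd (a +ₙ b′ +ₙ c) fzero)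

  card-subsetOf : ∀ {n} {l : List (Fin n)} → Unique l → ∣ subsetOf l ∣ ≡ ∑[ _ ∈ l ] 1
  card-subsetOf {n} {l} ul = trans (card≡sumFin n (subsetOf l))
    (trans (sumFin-cong n (λ i → sym (*-identityʳ (mem (subsetOf l) i)))) (sumFin-subsetOf l ul (λ _ → 1)))

  subsetOf-nonempty : ∀ {n} {x : Fin n} {l} → x ∈ l → Nonempty (subsetOf l)
  subsetOf-nonempty {x = x} {l} x∈l =
    x , lookup⇒[]= x (subsetOf l) (trans (lookup∘tabulate _ x) (dec-true (any? (x Fin.≟_) l) x∈l))

module ZeroSums where

  open Sums using (δ; δ-refl)
  open import Defs using (𝟙; eqInd; _+ₙ_)
  open import Data.Nat using (ℕ; suc; _+_; _∸_; _≤_; _<_; _≟_; NonZero)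
  open import Data.Nat.Properties
  open import Data.Nat.DivMod using (_%_; _mod_; m<n⇒m%n≡m; n%n≡0; [m+n]%n≡m%n)
  open import Data.Fin using (Fin; toℕ) renaming (zero to fzero; suc to fsuc)
  import Data.Fin.Properties as Fin
  open import Relation.Nullary using (yes; no)
  open import Relation.Nullary.Decidable using (dec-false)
  open import Relation.Binary using (tri<; tri≈; tri>)
  open import Relation.Binary.PropositionalEquality

  toℕ-mod : ∀ v n .{{_ : NonZero n}} → toℕ (v mod n) ≡ v % n
  toℕ-mod v n = Fin.toℕ-fromℕ< _

  eqInd-fzero : ∀ {m} (x : Fin (suc m)) → eqInd x fzero ≡ δ (toℕ x) 0
  eqInd-fzero fzero    = refl
  eqInd-fzero (fsuc x) = refl

  -- For 0 < q < n and s ≤ n, the number q + (n ∸ s) lies in (0, 2n), so it is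
  -- divisible by n only if it equals n, i.e. only if q = s.
  δ-%-shift : ∀ {n q s} .{{_ : NonZero n}} → 0 < q → q < n → s ≤ n →
    δ ((q + (n ∸ s)) % n) 0 ≡ δ q s
  δ-%-shift {n} {q} {s} 0<q q<n s≤n with q ≟ s
  ... | yes refl = begin
    δ ((q + (n ∸ q)) % n) 0   ≡⟨ cong (λ v → δ (v % n) 0) (m+[n∸m]≡n s≤n) ⟩
    δ (n % n) 0               ≡⟨ cong (λ v → δ v 0) (n%n≡0 n) ⟩
    δ 0 0                     ≡⟨ δ-refl q ⟨
    δ q q                     ∎
    where open ≡-Reasoning
  ... | no  q≢s  = trans (cong 𝟙 (dec-false (_ ≟ 0) residue≢0)) (sym (cong 𝟙 (dec-false (q ≟ s) q≢s)))
    where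
    residue≢0 : (q + (n ∸ s)) % n ≢ 0
    residue≢0 with <-cmp q s
    ... | tri≈ _ q≡s _ = λ _ → q≢s q≡s
    ... | tri< q<s _ _ = λ r≡0 → >⇒≢ (≤-trans 0<q (m≤m+n q _)) (trans (sym (m<n⇒m%n≡m below)) r≡0)
      where
      below : q + (n ∸ s) < n
      below = ≤-trans (+-monoˡ-< (n ∸ s) q<s) (≤-reflexive (m+[n∸m]≡n s≤n))
    ... | tri> _ _ s<q = λ r≡0 → m>n⇒m∸n≢0 s<q (begin
      q ∸ s                  ≡⟨ m<n⇒m%n≡m (≤-<-trans (m∸n≤m q s) q<n) ⟨
      (q ∸ s) % n            ≡⟨ [m+n]%n≡m%n (q ∸ s) n ⟨
      (q ∸ s + n) % n        ≡⟨ cong (_% n) (+-∸-comm n (<⇒≤ s<q)) ⟨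
      (q + n ∸ s) % n        ≡⟨ cong (_% n) (+-∸-assoc q s≤n) ⟩
      (q + (n ∸ s)) % n      ≡⟨ r≡0 ⟩
      0                      ∎)
      where open ≡-Reasoning

  zeroSum-noWrap : ∀ {m} (a b c : Fin (suc m)) {x y s} →
    toℕ a ≡ x → toℕ b ≡ y → toℕ c ≡ suc m ∸ s → 0 < x + y → x + y < suc m → s ≤ suc m →
    eqInd (a +ₙ b +ₙ c) fzero ≡ δ (x + y) s
  zeroSum-noWrap {m} a b c {s = s} refl refl c≡n∸s 0<q q<n s≤n = begin
    eqInd (a +ₙ b +ₙ c) fzero
      ≡⟨ eqInd-fzero (a +ₙ b +ₙ c) ⟩
    δ (toℕ (a +ₙ b +ₙ c)) 0
      ≡⟨ cong (λ v → δ v 0) (toℕ-mod (toℕ (a +ₙ b) + toℕ c) (suc m)) ⟩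
    δ ((toℕ (a +ₙ b) + toℕ c) % suc m) 0
      ≡⟨ cong (λ v → δ ((v + toℕ c) % suc m) 0) toℕ[a+b]≡q ⟩
    δ ((q + toℕ c) % suc m) 0
      ≡⟨ cong (λ v → δ ((q + v) % suc m) 0) c≡n∸s ⟩
    δ ((q + (suc m ∸ s)) % suc m) 0
      ≡⟨ δ-%-shift 0<q q<n s≤n ⟩
    δ q s ∎
    where
    open ≡-Reasoning
    q : ℕ
    q = toℕ a + toℕ b
    toℕ[a+b]≡q : toℕ (a +ₙ b) ≡ q
    toℕ[a+b]≡q = trans (toℕ-mod q (suc m)) (m<n⇒m%n≡m q<n)

module Digits where

  open import Data.Nat
  open import Data.Nat.Properties
  open import Data.Nat.DivMod using (_%_; m<n⇒m%n≡m; [m+kn]%n≡m%n)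
  open import Data.Nat.Tactic.RingSolver using (solve-∀)
  open import Data.Fin using (Fin; toℕ; fromℕ<)
  import Data.Fin.Properties as Fin
  open import Data.Vec using (Vec; []; _∷_; map; zipWith)
  open import Data.Vec.Properties using (∷-injective)
  open import Data.Vec.Relation.Unary.All using (All; []; _∷_)
  open import Data.Product using (_×_; _,_)
  open import Relation.Binary.PropositionalEquality

  fromDigits : ∀ {k} → ℕ → Vec ℕ k → ℕ
  fromDigits b []      = 0
  fromDigits b (h ∷ t) = h + fromDigits b t * b

  infixl 6 _⊕_
  _⊕_ : ∀ {k} → Vec ℕ k → Vec ℕ k → Vec ℕ k
  _⊕_ = zipWith _+_

  fromDigits-⊕ : ∀ {k} b (u v : Vec ℕ k) → fromDigits b (u ⊕ v) ≡ fromDigits b u + fromDigits b v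
  fromDigits-⊕ b []      []      = refl
  fromDigits-⊕ b (x ∷ u) (y ∷ v) =
    trans (cong (λ t → x + y + t * b) (fromDigits-⊕ b u v)) (shuffle x y b (fromDigits b u) (fromDigits b v))
    where
    shuffle : ∀ x y b p q → x + y + (p + q) * b ≡ x + p * b + (y + q * b)
    shuffle = solve-∀

  digit-< : ∀ {B T h t} → h < B → t < T → h + t * B < T * B
  digit-< {B} {T} {h} {t} h<B t<T = begin-strict
    h + t * B  <⟨ +-monoˡ-< (t * B) h<B ⟩
    suc t * B  ≤⟨ *-monoˡ-≤ B t<T ⟩
    T * B      ∎
    where open ≤-Reasoning

  digit-injective : ∀ {B h h′ t t′} → h < B → h′ < B → h + t * B ≡ h′ + t′ * B → h ≡ h′ × t ≡ t′
  digit-injective {B} {h} {h′} {t} {t′} h<B h′<B eq =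
    h≡h′ , *-cancelʳ-≡ t t′ B (+-cancelˡ-≡ h _ _ (trans eq (cong (_+ t′ * B) (sym h≡h′))))
    where
    instance
      _ : NonZero B
      _ = >-nonZero (≤-<-trans z≤n h<B)
    open ≡-Reasoning
    h≡h′ : h ≡ h′
    h≡h′ = begin
      h                ≡⟨ m<n⇒m%n≡m h<B ⟨
      h % B            ≡⟨ [m+kn]%n≡m%n h t B ⟨
      (h + t * B) % B  ≡⟨ cong (_% B) eq ⟩
      (h′ + t′ * B) % B ≡⟨ [m+kn]%n≡m%n h′ t′ B ⟩
      h′ % B           ≡⟨ m<n⇒m%n≡m h′<B ⟩
      h′               ∎

  fromDigits-∷-injective : ∀ {k B h h′} (u v : Vec ℕ k) → h < B → h′ < B →
    fromDigits B (h ∷ u) ≡ fromDigits B (h′ ∷ v) → h ≡ h′ × fromDigits B u ≡ fromDigits B v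
  fromDigits-∷-injective u v = digit-injective

  fromDigits-< : ∀ {k b} {u : Vec ℕ k} → All (_< b) u → fromDigits b u < b ^ k
  fromDigits-< {b = b} []                 = s≤s z≤n
  fromDigits-< {suc k} {b} {h ∷ t} (h<b ∷ t<) =
    subst (h + fromDigits b t * b <_) (*-comm (b ^ k) b) (digit-< h<b (fromDigits-< t<))

  fromDigits-injective : ∀ {k b} {u v : Vec ℕ k} → All (_< b) u → All (_< b) v →
    fromDigits b u ≡ fromDigits b v → u ≡ v
  fromDigits-injective []           []           _  = refl
  fromDigits-injective (x<b ∷ u<b) (y<b ∷ v<b) eq with digit-injective x<b y<b eq
  ... | x≡y , rest≡ = cong₂ _∷_ x≡y (fromDigits-injective u<b v<b rest≡)

  values : ∀ {d k} → Vec (Fin d) k → Vec ℕ k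
  values = map toℕ

  values-injective : ∀ {d k} {u v : Vec (Fin d) k} → values u ≡ values v → u ≡ v
  values-injective {u = []}    {[]}    _  = refl
  values-injective {u = x ∷ u} {y ∷ v} eq with ∷-injective eq
  ... | x≡y , u≡v = cong₂ _∷_ (Fin.toℕ-injective x≡y) (values-injective u≡v)

  values-< : ∀ {d k b} → d ≤ b → (u : Vec (Fin d) k) → All (_< b) (values u)
  values-< d≤b []      = []
  values-< d≤b (x ∷ u) = ≤-trans (Fin.toℕ<n x) d≤b ∷ values-< d≤b u

  values-⊕-< : ∀ {d k} (u v : Vec (Fin d) k) → All (_< d + d) (values u ⊕ values v)
  values-⊕-< []      []      = []
  values-⊕-< (x ∷ u) (y ∷ v) = +-mono-<-≤ (Fin.toℕ<n x) (<⇒≤ (Fin.toℕ<n y)) ∷ values-⊕-< u v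

  _⊞_ : ∀ {d k} → Vec (Fin d) k → Vec (Fin d) k → Vec (Fin (d + d)) k
  []      ⊞ []      = []
  (x ∷ u) ⊞ (y ∷ v) = fromℕ< (+-mono-<-≤ (Fin.toℕ<n x) (<⇒≤ (Fin.toℕ<n y))) ∷ (u ⊞ v)

  values-⊞ : ∀ {d k} (u v : Vec (Fin d) k) → values (u ⊞ v) ≡ values u ⊕ values v
  values-⊞ []      []      = refl
  values-⊞ (x ∷ u) (y ∷ v) = cong₂ _∷_ (Fin.toℕ-fromℕ< _) (values-⊞ u v)

module Rigidity where

  open Digits using (_⊕_; values)
  open import Data.Nat
  open import Data.Nat.Properties
  open import Data.Nat.Tactic.RingSolver using (solve-∀)
  open import Data.Fin using (Fin)
  import Data.Fin.Properties as Fin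
  open import Data.Vec using (Vec; []; _∷_)
  open import Data.Vec.Properties using (∷-injective)
  open import Data.Product using (_,_)
  open import Data.Sum using (inj₁; inj₂)
  open import Relation.Binary.PropositionalEquality

  ‖_‖² : ∀ {k} → Vec ℕ k → ℕ
  ‖ []    ‖² = 0
  ‖ h ∷ t ‖² = h * h + ‖ t ‖²

  dist² : ∀ {k} → Vec ℕ k → Vec ℕ k → ℕ
  dist² []      []      = 0
  dist² (x ∷ u) (y ∷ v) = ∣ x - y ∣ * ∣ x - y ∣ + dist² u v

  ‖values‖²≤ : ∀ {d k} (u : Vec (Fin d) k) → ‖ values u ‖² ≤ k * (d * d)
  ‖values‖²≤ []      = z≤n
  ‖values‖²≤ (x ∷ u) = +-mono-≤ (*-mono-≤ (<⇒≤ (Fin.toℕ<n x)) (<⇒≤ (Fin.toℕ<n x))) (‖values‖²≤ u)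

  parallelogram₁-≤ : ∀ {x y} → x ≤ y → 2 * (x * x + y * y) ≡ (x + y) * (x + y) + ∣ x - y ∣ * ∣ x - y ∣
  parallelogram₁-≤ {x} x≤y with t , refl ← m≤n⇒∃[o]m+o≡n x≤y =
    subst (λ e → 2 * (x * x + (x + t) * (x + t)) ≡ (x + (x + t)) * (x + (x + t)) + e * e)
      (sym (∣m-m+n∣≡n x t)) (identity x t)
    where
    identity : ∀ x t → 2 * (x * x + (x + t) * (x + t)) ≡ (x + (x + t)) * (x + (x + t)) + t * t
    identity = solve-∀

  parallelogram₁ : ∀ x y → 2 * (x * x + y * y) ≡ (x + y) * (x + y) + ∣ x - y ∣ * ∣ x - y ∣
  parallelogram₁ x y with ≤-total x y
  ... | inj₁ x≤y = parallelogram₁-≤ x≤y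
  ... | inj₂ y≤x = begin
    2 * (x * x + y * y)
      ≡⟨ cong (2 *_) (+-comm (x * x) (y * y)) ⟩
    2 * (y * y + x * x)
      ≡⟨ parallelogram₁-≤ y≤x ⟩
    (y + x) * (y + x) + ∣ y - x ∣ * ∣ y - x ∣
      ≡⟨ cong₂ (λ s e → s * s + e * e) (+-comm y x) (∣-∣-comm y x) ⟩
    (x + y) * (x + y) + ∣ x - y ∣ * ∣ x - y ∣ ∎
    where open ≡-Reasoning

  parallelogram : ∀ {k} (u v : Vec ℕ k) → 2 * (‖ u ‖² + ‖ v ‖²) ≡ ‖ u ⊕ v ‖² + dist² u v
  parallelogram []      []      = refl
  parallelogram (x ∷ u) (y ∷ v) = begin
    2 * (x * x + ‖ u ‖² + (y * y + ‖ v ‖²))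
      ≡⟨ regroup (x * x) (‖ u ‖²) (y * y) (‖ v ‖²) ⟩
    2 * (x * x + y * y) + 2 * (‖ u ‖² + ‖ v ‖²)
      ≡⟨ cong₂ _+_ (parallelogram₁ x y) (parallelogram u v) ⟩
    ((x + y) * (x + y) + ∣ x - y ∣ * ∣ x - y ∣) + (‖ u ⊕ v ‖² + dist² u v)
      ≡⟨ interchange ((x + y) * (x + y)) (∣ x - y ∣ * ∣ x - y ∣) (‖ u ⊕ v ‖²) (dist² u v) ⟩
    ((x + y) * (x + y) + ‖ u ⊕ v ‖²) + (∣ x - y ∣ * ∣ x - y ∣ + dist² u v) ∎
    where
    open ≡-Reasoning
    regroup : ∀ p q r s → 2 * (p + q + (r + s)) ≡ 2 * (p + r) + 2 * (q + s)
    regroup = solve-∀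
    interchange : ∀ p q r s → (p + q) + (r + s) ≡ (p + r) + (q + s)
    interchange = solve-∀

  dist²≡0⇒≡ : ∀ {k} (u v : Vec ℕ k) → dist² u v ≡ 0 → u ≡ v
  dist²≡0⇒≡ []      []      _  = refl
  dist²≡0⇒≡ (x ∷ u) (y ∷ v) eq =
    cong₂ _∷_ (∣m-n∣≡0⇒m≡n (m*m≡0⇒m≡0 (m+n≡0⇒m≡0 _ eq))) (dist²≡0⇒≡ u v (m+n≡0⇒n≡0 _ eq))
    where
    m*m≡0⇒m≡0 : ∀ {m} → m * m ≡ 0 → m ≡ 0
    m*m≡0⇒m≡0 {zero} _ = refl

  ‖u⊕u‖² : ∀ {k} (u : Vec ℕ k) → ‖ u ⊕ u ‖² ≡ 2 * (‖ u ‖² + ‖ u ‖²)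
  ‖u⊕u‖² []      = refl
  ‖u⊕u‖² (x ∷ u) = trans (cong ((x + x) * (x + x) +_) (‖u⊕u‖² u)) (identity x ‖ u ‖²)
    where
    identity : ∀ x s → (x + x) * (x + x) + 2 * (s + s) ≡ 2 * (x * x + s + (x * x + s))
    identity = solve-∀

  -- By the parallelogram law the hypotheses force dist² u v = 0.
  rigidity : ∀ {k} (u v w : Vec ℕ k) →
    u ⊕ v ≡ w ⊕ w → ‖ u ‖² + ‖ v ‖² ≡ ‖ w ‖² + ‖ w ‖² → u ≡ v
  rigidity u v w sum≡ sq≡ = dist²≡0⇒≡ u v (+-cancelˡ-≡ ‖ u ⊕ v ‖² _ 0 (begin
    ‖ u ⊕ v ‖² + dist² u v   ≡⟨ parallelogram u v ⟨
    2 * (‖ u ‖² + ‖ v ‖²)    ≡⟨ cong (2 *_) sq≡ ⟩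
    2 * (‖ w ‖² + ‖ w ‖²)    ≡⟨ ‖u⊕u‖² w ⟨
    ‖ w ⊕ w ‖²               ≡⟨ cong ‖_‖² sum≡ ⟨
    ‖ u ⊕ v ‖²               ≡⟨ +-identityʳ _ ⟨
    ‖ u ⊕ v ‖² + 0           ∎))
    where open ≡-Reasoning

  ⊕-self-injective : ∀ {k} {u v : Vec ℕ k} → u ⊕ u ≡ v ⊕ v → u ≡ v
  ⊕-self-injective {u = []}    {[]}    _  = refl
  ⊕-self-injective {u = x ∷ u} {y ∷ v} eq with ∷-injective eq
  ... | x+x≡y+y , rest = cong₂ _∷_ (*-cancelˡ-≡ x y 2 2x≡2y) (⊕-self-injective rest)
    where
    2x≡2y : 2 * x ≡ 2 * y
    2x≡2y = trans (cong (x +_) (+-identityʳ x)) (trans x+x≡y+y (sym (cong (y +_) (+-identityʳ y))))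

module VectorEnumeration where

  open Sums using (∑; ∑-cong; ∑-const; ∑-cartesianProductWith)
  open import Data.Nat using (zero; suc; _*_; _^_)
  open import Data.Nat.Properties using (*-assoc)
  open import Data.Fin using (Fin)
  open import Data.Vec using (Vec; []; _∷_)
  open import Data.Vec.Properties using (∷-injective)
  open import Data.List using (List; []; _∷_; allFin; cartesianProductWith; length)
  open import Data.List.Properties using (length-tabulate)
  open import Data.List.Membership.Propositional using (_∈_)
  open import Data.List.Membership.Propositional.Properties using (∈-allFin; ∈-cartesianProductWith⁺)
  open import Data.List.Relation.Unary.Any using (here)
  import Data.List.Relation.Unary.All as ListAll
  open import Data.List.Relation.Unary.AllPairs using ([]; _∷_)
  open import Data.List.Relation.Unary.Unique.Propositional using (Unique)
  import Data.List.Relation.Unary.Unique.Propositional.Properties as Unique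
  open import Relation.Binary.PropositionalEquality

  allVecs : ∀ d k → List (Vec (Fin d) k)
  allVecs d zero    = [] ∷ []
  allVecs d (suc k) = cartesianProductWith _∷_ (allFin d) (allVecs d k)

  allVecs-unique : ∀ d k → Unique (allVecs d k)
  allVecs-unique d zero    = ListAll.[] ∷ []
  allVecs-unique d (suc k) =
    Unique.cartesianProductWith⁺ _∷_ ∷-injective (Unique.allFin⁺ d) (allVecs-unique d k)

  ∈-allVecs : ∀ {d k} (v : Vec (Fin d) k) → v ∈ allVecs d k
  ∈-allVecs []      = here refl
  ∈-allVecs (x ∷ v) = ∈-cartesianProductWith⁺ _∷_ (∈-allFin x) (∈-allVecs v)

  ∑-allVecs-const : ∀ d k c → ∑[ _ ∈ allVecs d k ] c ≡ d ^ k * c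
  ∑-allVecs-const d zero    c = refl
  ∑-allVecs-const d (suc k) c = begin
    ∑[ _ ∈ allVecs d (suc k) ] c
      ≡⟨ ∑-cartesianProductWith _∷_ (allFin d) (allVecs d k) (λ _ → c) ⟩
    ∑[ _ ∈ allFin d ] ∑[ _ ∈ allVecs d k ] c
      ≡⟨ ∑-cong (allFin d) (λ _ → ∑-allVecs-const d k c) ⟩
    ∑[ _ ∈ allFin d ] (d ^ k * c)
      ≡⟨ ∑-const (allFin d) (d ^ k * c) ⟩
    length (allFin d) * (d ^ k * c)
      ≡⟨ cong (_* (d ^ k * c)) (length-tabulate {n = d} (λ i → i)) ⟩
    d * (d ^ k * c)
      ≡⟨ *-assoc d (d ^ k) c ⟨
    d ^ suc k * c ∎
    where open ≡-Reasoning

module Construction where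

  open Sums
  open ListSubsets
  open ZeroSums using (zeroSum-noWrap)
  open Digits
  open Rigidity
  open VectorEnumeration
  open import Defs using (eqInd; _+ₙ_; triangles; pairSum)
  open import Data.Nat
  open import Data.Nat.Properties
  open import Data.Fin using (Fin; fromℕ<) renaming (zero to fzero)
  import Data.Fin.Properties as Fin
  open import Data.Fin.Subset using (Subset; Nonempty; ∣_∣)
  open import Data.Vec using (Vec; []; _∷_; replicate; tail)
  open import Data.List using (List; map; cartesianProduct)
  open import Data.List.Membership.Propositional.Properties using (∈-cartesianProduct⁺; ∈-map⁺)
  open import Data.List.Relation.Unary.Unique.Propositional using (Unique)
  import Data.List.Relation.Unary.Unique.Propositional.Properties as Unique
  open import Data.Product using (Σ; ∃; _×_; _,_; proj₁; proj₂)
  open import Function using (_∘_)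
  open import Relation.Binary.PropositionalEquality

  -- Each sum encA p + encA q and each encS r has base-(2d)ᵏ digits below (2d)ᵏ, (2d)ᵏ and 3 + 2kd².
  minModulus : ℕ → ℕ → ℕ
  minModulus d k = suc (suc Q + suc Q) * (d + d) ^ k * (d + d) ^ k
    where
    Q : ℕ
    Q = k * (d * d)

  GoodTriple : ℕ → (ℕ → Set) → Set
  GoodTriple m P = Σ (Subset (suc m)) λ A → Σ (Subset (suc m)) λ B → Σ (Subset (suc m)) λ C →
    Nonempty A × Nonempty B × Nonempty C × pairSum A B C ≤ ∣ A ∣ * ∣ B ∣ × P (triangles A B C)

  GoodTriple-map : ∀ {m} {P Q : ℕ → Set} → (∀ {T} → P T → Q T) → GoodTriple m P → GoodTriple m Q
  GoodTriple-map P⇒Q (A , B , C , A≢∅ , B≢∅ , C≢∅ , pairs≤ , pT) =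
    A , B , C , A≢∅ , B≢∅ , C≢∅ , pairs≤ , P⇒Q pT

  module Encoding (d′ k m : ℕ) (n-large : minModulus (suc d′) k ≤ suc m) where

    d b B n Q : ℕ
    d = suc d′
    b = d + d
    B = b ^ k
    n = suc m
    Q = k * (d * d)

    V W : Set
    V = Vec (Fin d) k
    W = Vec (Fin b) k

    ⟨_⟩ : Vec ℕ k → ℕ
    ⟨ u ⟩ = fromDigits b u

    -- A = B consists of the residues encA p and C of the residues −encS r, so that
    -- a + b + c = 0 means encA p + encA q = encS r once no wraparound occurs.
    digitsA : V × V → Vec ℕ 3
    digitsA (u , x) = ⟨ values u ⟩ ∷ ⟨ values x ⟩ ∷ suc ‖ values x ‖² ∷ []

    digitsS : W × V → Vec ℕ 3
    digitsS (w , z) =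
      ⟨ values w ⟩ ∷ ⟨ values z ⊕ values z ⟩ ∷ (suc ‖ values z ‖² + suc ‖ values z ‖²) ∷ []

    encA : V × V → ℕ
    encA p = fromDigits B (digitsA p)

    encS : W × V → ℕ
    encS r = fromDigits B (digitsS r)

    ⟨V⟩<B : (u : V) → ⟨ values u ⟩ < B
    ⟨V⟩<B u = fromDigits-< (values-< (m≤m+n d d) u)

    ⟨W⟩<B : (w : W) → ⟨ values w ⟩ < B
    ⟨W⟩<B w = fromDigits-< (values-< ≤-refl w)

    ⟨V⊕V⟩<B : (u v : V) → ⟨ values u ⊕ values v ⟩ < B
    ⟨V⊕V⟩<B u v = fromDigits-< (values-⊕-< u v)

    digitsA₊ : V × V → V × V → Vec ℕ 3
    digitsA₊ (u , x) (v , y) =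
      ⟨ values u ⊕ values v ⟩ ∷ ⟨ values x ⊕ values y ⟩
        ∷ (suc ‖ values x ‖² + suc ‖ values y ‖²) ∷ []

    encA-+ : ∀ p q → encA p + encA q ≡ fromDigits B (digitsA₊ p q)
    encA-+ p@(u , x) q@(v , y) = trans (sym (fromDigits-⊕ B (digitsA p) (digitsA q)))
      (cong (fromDigits B) (sym (cong₂ (λ s t → s ∷ t ∷ (suc ‖ values x ‖² + suc ‖ values y ‖²) ∷ [])
        (fromDigits-⊕ b (values u) (values v)) (fromDigits-⊕ b (values x) (values y)))))

    three-digits-< : ∀ {h₀ h₁ h₂} → h₀ < B → h₁ < B → h₂ ≤ suc Q + suc Q →
      fromDigits B (h₀ ∷ h₁ ∷ h₂ ∷ []) < n
    three-digits-< h₀<B h₁<B h₂≤ =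
      ≤-trans (digit-< h₀<B (digit-< h₁<B (s≤s (≤-trans (≤-reflexive (+-identityʳ _)) h₂≤)))) n-large

    three-digits-pos : ∀ h₀ h₁ h₂ → 0 < h₂ → 0 < fromDigits B (h₀ ∷ h₁ ∷ h₂ ∷ [])
    three-digits-pos h₀ h₁ h₂ 0<h₂ = ≤-trans (*-mono-≤ 0<h₁+h₂B 0<B) (m≤n+m _ h₀)
      where
      0<B : 0 < B
      0<B = m^n>0 b k
      0<h₁+h₂B : 0 < h₁ + (h₂ + 0) * B
      0<h₁+h₂B = ≤-trans (*-mono-≤ (≤-trans 0<h₂ (m≤m+n h₂ 0)) 0<B) (m≤n+m _ h₁)

    top≤ : ∀ (x y : V) → suc ‖ values x ‖² + suc ‖ values y ‖² ≤ suc Q + suc Q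
    top≤ x y = +-mono-≤ (s≤s (‖values‖²≤ x)) (s≤s (‖values‖²≤ y))

    encA-+-< : ∀ p q → encA p + encA q < n
    encA-+-< p@(u , x) q@(v , y) =
      subst (_< n) (sym (encA-+ p q)) (three-digits-< (⟨V⊕V⟩<B u v) (⟨V⊕V⟩<B x y) (top≤ x y))

    encA-+-pos : ∀ p q → 0 < encA p + encA q
    encA-+-pos p@(u , x) q@(v , y) = subst (0 <_) (sym (encA-+ p q))
      (three-digits-pos ⟨ values u ⊕ values v ⟩ ⟨ values x ⊕ values y ⟩
        (suc ‖ values x ‖² + suc ‖ values y ‖²) (s≤s z≤n))

    encA-< : ∀ p → encA p < n
    encA-< p = ≤-<-trans (m≤m+n (encA p) (encA p)) (encA-+-< p p)

    encS-< : ∀ r → encS r < n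
    encS-< (w , z) = three-digits-< (⟨W⟩<B w) (⟨V⊕V⟩<B z z) (top≤ z z)

    encS-pos : ∀ r → 0 < encS r
    encS-pos (w , z) =
      three-digits-pos ⟨ values w ⟩ ⟨ values z ⊕ values z ⟩
        (suc ‖ values z ‖² + suc ‖ values z ‖²) (s≤s z≤n)

    ⟨V⟩-injective : ∀ {u v : V} → ⟨ values u ⟩ ≡ ⟨ values v ⟩ → u ≡ v
    ⟨V⟩-injective {u} {v} =
      values-injective ∘ fromDigits-injective (values-< (m≤m+n d d) u) (values-< (m≤m+n d d) v)

    ⟨W⟩-injective : ∀ {w w′ : W} → ⟨ values w ⟩ ≡ ⟨ values w′ ⟩ → w ≡ w′
    ⟨W⟩-injective {w} {w′} =
      values-injective ∘ fromDigits-injective (values-< ≤-refl w) (values-< ≤-refl w′)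

    ⟨V⊕V⟩-injective : ∀ {u v x y : V} → ⟨ values u ⊕ values v ⟩ ≡ ⟨ values x ⊕ values y ⟩ →
      values u ⊕ values v ≡ values x ⊕ values y
    ⟨V⊕V⟩-injective {u} {v} {x} {y} = fromDigits-injective (values-⊕-< u v) (values-⊕-< x y)

    encA-injective : ∀ {p q} → encA p ≡ encA q → p ≡ q
    encA-injective {p@(u , x)} {q@(v , y)} eq
      with fromDigits-∷-injective (tail (digitsA p)) (tail (digitsA q)) (⟨V⟩<B u) (⟨V⟩<B v) eq
    ... | u≡v , rest
      with fromDigits-∷-injective (tail (tail (digitsA p))) (tail (tail (digitsA q))) (⟨V⟩<B x) (⟨V⟩<B y) rest
    ...   | x≡y , _ = cong₂ _,_ (⟨V⟩-injective u≡v) (⟨V⟩-injective x≡y)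

    encS-injective : ∀ {r s} → encS r ≡ encS s → r ≡ s
    encS-injective {r@(w , z)} {s@(w′ , z′)} eq
      with fromDigits-∷-injective (tail (digitsS r)) (tail (digitsS s)) (⟨W⟩<B w) (⟨W⟩<B w′) eq
    ... | w≡w′ , rest
      with fromDigits-∷-injective (tail (tail (digitsS r))) (tail (tail (digitsS s)))
             (⟨V⊕V⟩<B z z) (⟨V⊕V⟩<B z′ z′) rest
    ...   | z≡z′ , _ =
      cong₂ _,_ (⟨W⟩-injective w≡w′) (values-injective (⊕-self-injective (⟨V⊕V⟩-injective z≡z′)))

    -- Comparing digits gives x + y = 2z and ‖x‖² + ‖y‖² = 2‖z‖²; rigidity then forces x = y = z.
    encA-+-encS : ∀ u x v y w z → encA (u , x) + encA (v , y) ≡ encS (w , z) →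
      values u ⊕ values v ≡ values w × x ≡ z × y ≡ z
    encA-+-encS u x v y w z eq
      with fromDigits-∷-injective (tail (digitsA₊ (u , x) (v , y))) (tail (digitsS (w , z))) (⟨V⊕V⟩<B u v) (⟨W⟩<B w)
             (trans (sym (encA-+ (u , x) (v , y))) eq)
    ... | uv≡w , rest
      with fromDigits-∷-injective (tail (tail (digitsA₊ (u , x) (v , y)))) (tail (tail (digitsS (w , z))))
             (⟨V⊕V⟩<B x y) (⟨V⊕V⟩<B z z) rest
    ...   | xy≡zz , top≡ =
      fromDigits-injective (values-⊕-< u v) (values-< ≤-refl w) uv≡w , values-injective x≡z , values-injective y≡z
      where
      sums≡ : values x ⊕ values y ≡ values z ⊕ values z
      sums≡ = ⟨V⊕V⟩-injective xy≡zz
      squares≡ : ‖ values x ‖² + ‖ values y ‖² ≡ ‖ values z ‖² + ‖ values z ‖²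
      squares≡ = suc-injective (suc-injective (begin
        suc (suc (‖ values x ‖² + ‖ values y ‖²))   ≡⟨ cong suc (+-suc _ _) ⟨
        suc ‖ values x ‖² + suc ‖ values y ‖²       ≡⟨ +-identityʳ _ ⟨
        suc ‖ values x ‖² + suc ‖ values y ‖² + 0   ≡⟨ top≡ ⟩
        suc ‖ values z ‖² + suc ‖ values z ‖² + 0   ≡⟨ +-identityʳ _ ⟩
        suc ‖ values z ‖² + suc ‖ values z ‖²       ≡⟨ cong suc (+-suc _ _) ⟩
        suc (suc (‖ values z ‖² + ‖ values z ‖²))   ∎))
        where open ≡-Reasoning
      x≡y : values x ≡ values y
      x≡y = rigidity (values x) (values y) (values z) sums≡ squares≡
      x≡z : values x ≡ values z
      x≡z = ⊕-self-injective (trans (cong (values x ⊕_) x≡y) sums≡)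
      y≡z : values y ≡ values z
      y≡z = trans (sym x≡y) x≡z

    P : List (V × V)
    P = cartesianProduct (allVecs d k) (allVecs d k)

    R : List (W × V)
    R = cartesianProduct (allVecs b k) (allVecs d k)

    ∑-P : ∀ g → ∑ P g ≡ ∑[ u ∈ allVecs d k ] ∑[ x ∈ allVecs d k ] g (u , x)
    ∑-P = ∑-cartesianProductWith _,_ (allVecs d k) (allVecs d k)

    ∑-P-const : ∀ c → ∑[ _ ∈ P ] c ≡ d ^ k * (d ^ k * c)
    ∑-P-const c = trans (∑-P (λ _ → c))
      (trans (∑-cong (allVecs d k) (λ _ → ∑-allVecs-const d k c)) (∑-allVecs-const d k (d ^ k * c)))

    P-unique : Unique P
    P-unique = Unique.cartesianProduct⁺ (allVecs-unique d k) (allVecs-unique d k)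

    R-unique : Unique R
    R-unique = Unique.cartesianProduct⁺ (allVecs-unique b k) (allVecs-unique d k)

    embedA : V × V → Fin n
    embedA p = fromℕ< (encA-< p)

    n∸encS<n : ∀ r → n ∸ encS r < n
    n∸encS<n r = ∸-monoʳ-< (encS-pos r) (<⇒≤ (encS-< r))

    embedC : W × V → Fin n
    embedC r = fromℕ< (n∸encS<n r)

    LA : List (Fin n)
    LA = map embedA P

    LC : List (Fin n)
    LC = map embedC R

    LA-unique : Unique LA
    LA-unique = Unique.map⁺ (λ {p} {q} eq →
      encA-injective (Fin.fromℕ<-injective (encA p) (encA q) (encA-< p) (encA-< q) eq)) P-unique

    LC-unique : Unique LC
    LC-unique = Unique.map⁺ (λ {r} {s} eq → encS-injective (∸-cancelˡ-≡ (<⇒≤ (encS-< r)) (<⇒≤ (encS-< s))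
      (Fin.fromℕ<-injective (n ∸ encS r) (n ∸ encS s) (n∸encS<n r) (n∸encS<n s) eq))) R-unique

    SA SC : Subset n
    SA = subsetOf LA
    SC = subsetOf LC

    hits : V × V → V × V → W × V → ℕ
    hits p q r = δ (encA p + encA q) (encS r)

    hits≤1 : ∀ p q r → hits p q r ≤ 1
    hits≤1 p q r = δ≤1 (encA p + encA q) (encS r)

    hits≢0 : ∀ p q r → hits p q r ≢ 0 → encA p + encA q ≡ encS r
    hits≢0 p q r = δ≢0⇒≡ {encA p + encA q} {encS r}

    eqInd-embed : ∀ p q r → eqInd (embedA p +ₙ embedA q +ₙ embedC r) fzero ≡ hits p q r
    eqInd-embed p q r = zeroSum-noWrap (embedA p) (embedA q) (embedC r)
      (Fin.toℕ-fromℕ< _) (Fin.toℕ-fromℕ< _) (Fin.toℕ-fromℕ< _)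
      (encA-+-pos p q) (encA-+-< p q) (<⇒≤ (encS-< r))

    card-SA : ∣ SA ∣ ≡ (d ^ k) ^ 2
    card-SA = trans (card-subsetOf LA-unique) (trans (∑-map embedA P (λ _ → 1)) (∑-P-const 1))

    triangles-SA-SC : triangles SA SA SC ≡ ∑[ p ∈ P ] ∑[ q ∈ P ] ∑[ r ∈ R ] hits p q r
    triangles-SA-SC = trans (triangles-subsetOf LA-unique LA-unique LC-unique)
      (trans (∑-map embedA P _) (∑-cong P (λ p →
        trans (∑-map embedA P _) (∑-cong P (λ q →
          trans (∑-map embedC R _) (∑-cong R (λ r → eqInd-embed p q r)))))))

    pairSum-SA-SC : pairSum SA SA SC ≡
      ∑[ a′ ∈ P ] ∑[ b′ ∈ P ] ∑[ a ∈ P ] ∑[ b ∈ P ] ∑[ c ∈ R ] (hits a′ b c * hits a b′ c)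
    pairSum-SA-SC = trans (pairSum-subsetOf LA-unique LA-unique LC-unique)
      (trans (∑-map embedA P _) (∑-cong P (λ a′ →
        trans (∑-map embedA P _) (∑-cong P (λ b′ →
          trans (∑-map embedA P _) (∑-cong P (λ a →
            trans (∑-map embedA P _) (∑-cong P (λ b →
              trans (∑-map embedC R _) (∑-cong R (λ c →
                cong₂ _*_ (eqInd-embed a′ b c) (eqInd-embed a b′ c))))))))))))

    hits-diagonal : ∀ u x v → hits (u , x) (v , x) (u ⊞ v , x) ≡ 1
    hits-diagonal u x v = trans (cong (λ s → δ s (encS (u ⊞ v , x))) sum≡) (δ-refl (encS (u ⊞ v , x)))
      where
      sum≡ : encA (u , x) + encA (v , x) ≡ encS (u ⊞ v , x)
      sum≡ = trans (encA-+ (u , x) (v , x))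
        (cong (λ t → fromDigits B (⟨ t ⟩ ∷ tail (digitsS (u ⊞ v , x)))) (sym (values-⊞ u v)))

    triangles-≥ : (d ^ k) ^ 3 ≤ triangles SA SA SC
    triangles-≥ = begin
      (d ^ k) ^ 3
        ≡⟨ ∑-P-const (d ^ k * 1) ⟨
      ∑[ _ ∈ P ] (d ^ k * 1)
        ≡⟨ ∑-cong P (λ _ → ∑-allVecs-const d k 1) ⟨
      ∑[ (u , x) ∈ P ] ∑[ v ∈ allVecs d k ] 1
        ≤⟨ ∑-mono-≤ P (λ (u , x) → ∑-mono-≤ (allVecs d k) (λ v → diagonal u x v)) ⟩
      ∑[ (u , x) ∈ P ] ∑[ v ∈ allVecs d k ] ∑[ y ∈ allVecs d k ] ∑[ r ∈ R ] hits (u , x) (v , y) r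
        ≡⟨ ∑-cong P (λ p → ∑-P (λ q → ∑ R (hits p q))) ⟨
      ∑[ p ∈ P ] ∑[ q ∈ P ] ∑[ r ∈ R ] hits p q r
        ≡⟨ triangles-SA-SC ⟨
      triangles SA SA SC ∎
      where
      open ≤-Reasoning
      diagonal : ∀ u x v → 1 ≤ ∑[ y ∈ allVecs d k ] ∑[ r ∈ R ] hits (u , x) (v , y) r
      diagonal u x v = begin
        1
          ≡⟨ hits-diagonal u x v ⟨
        hits (u , x) (v , x) (u ⊞ v , x)
          ≤⟨ ∈⇒≤∑ (hits (u , x) (v , x)) (∈-cartesianProduct⁺ (∈-allVecs (u ⊞ v)) (∈-allVecs x)) ⟩
        ∑ R (hits (u , x) (v , x))
          ≤⟨ ∈⇒≤∑ (λ y → ∑ R (hits (u , x) (v , y))) (∈-allVecs x) ⟩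
        ∑[ y ∈ allVecs d k ] ∑[ r ∈ R ] hits (u , x) (v , y) r ∎

    ∑-hits-first≤1 : ∀ q r → ∑[ p ∈ P ] hits p q r ≤ 1
    ∑-hits-first≤1 q r = ∑≤-atMostOne P (λ p → hits p q r) 1 P-unique
      (λ p p′ h≢0 h′≢0 → encA-injective (+-cancelʳ-≡ (encA q) (encA p) (encA p′)
        (trans (hits≢0 p q r h≢0) (sym (hits≢0 p′ q r h′≢0)))))
      (λ p → hits≤1 p q r)

    ∑-hits-last≤1 : ∀ p q → ∑[ r ∈ R ] hits p q r ≤ 1
    ∑-hits-last≤1 p q = ∑≤-atMostOne R (hits p q) 1 R-unique
      (λ r r′ h≢0 h′≢0 → encS-injective (trans (sym (hits≢0 p q r h≢0)) (hits≢0 p q r′ h′≢0)))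
      (hits≤1 p q)

    -- Given a′, b′ and b, the points c = −(a′ + b) and a = −(b′ + c) are forced.
    collisions : V × V → V × V → V × V → ℕ
    collisions a′ b′ b = ∑[ c ∈ R ] ∑[ a ∈ P ] (hits a′ b c * hits a b′ c)

    collisions≤1 : ∀ a′ b′ b → collisions a′ b′ b ≤ 1
    collisions≤1 a′ b′ b = begin
      ∑[ c ∈ R ] ∑[ a ∈ P ] (hits a′ b c * hits a b′ c)
        ≡⟨ ∑-cong R (λ c → ∑-*ˡ P (hits a′ b c) (λ a → hits a b′ c)) ⟩
      ∑[ c ∈ R ] (hits a′ b c * ∑[ a ∈ P ] hits a b′ c)
        ≤⟨ ∑-mono-≤ R (λ c → *-monoʳ-≤ (hits a′ b c) (∑-hits-first≤1 b′ c)) ⟩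
      ∑[ c ∈ R ] (hits a′ b c * 1)
        ≡⟨ ∑-cong R (λ c → *-identityʳ _) ⟩
      ∑[ c ∈ R ] hits a′ b c
        ≤⟨ ∑-hits-last≤1 a′ b ⟩
      1 ∎
      where open ≤-Reasoning

    collisions≢0 : ∀ a′ b′ b → collisions a′ b′ b ≢ 0 →
      proj₂ b ≡ proj₂ a′ × proj₂ b′ ≡ proj₂ a′
    collisions≢0 a′@(u′ , x′) b′@(v′ , y′) b@(v , y) coll≢0 =
      trans (proj₂ first) (sym (proj₁ first)) , trans second (sym (proj₁ first))
      where
      witness-c : ∃ λ c → ∑[ a ∈ P ] (hits a′ b c * hits a b′ c) ≢ 0
      witness-c = ∑≢0⇒∃ R (λ c → ∑[ a ∈ P ] (hits a′ b c * hits a b′ c)) coll≢0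
      c : W × V
      c = proj₁ witness-c
      witness-a : ∃ λ a → hits a′ b c * hits a b′ c ≢ 0
      witness-a = ∑≢0⇒∃ P (λ a → hits a′ b c * hits a b′ c) (proj₂ witness-c)
      a : V × V
      a = proj₁ witness-a
      both≢0 : hits a′ b c ≢ 0 × hits a b′ c ≢ 0
      both≢0 = *≢0⇒≢0 (hits a′ b c) (hits a b′ c) (proj₂ witness-a)
      first : x′ ≡ proj₂ c × y ≡ proj₂ c
      first = proj₂ (encA-+-encS u′ x′ v y (proj₁ c) (proj₂ c) (hits≢0 a′ b c (proj₁ both≢0)))
      second : y′ ≡ proj₂ c
      second = proj₂ (proj₂ (encA-+-encS (proj₁ a) (proj₂ a) v′ y′ (proj₁ c) (proj₂ c)
                                          (hits≢0 a b′ c (proj₂ both≢0))))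

    column : V × V → V → V → ℕ
    column a′ v′ y′ = ∑[ b ∈ P ] collisions a′ (v′ , y′) b

    column≢0 : ∀ a′ v′ y′ → column a′ v′ y′ ≢ 0 → y′ ≡ proj₂ a′
    column≢0 a′ v′ y′ col≢0 with b , coll≢0 ← ∑≢0⇒∃ P (collisions a′ (v′ , y′)) col≢0 =
      proj₂ (collisions≢0 a′ (v′ , y′) b coll≢0)

    column≤ : ∀ a′ v′ y′ → column a′ v′ y′ ≤ d ^ k * 1
    column≤ a′ v′ y′ = begin
      column a′ v′ y′
        ≡⟨ ∑-P (collisions a′ (v′ , y′)) ⟩
      ∑[ v ∈ allVecs d k ] ∑[ y ∈ allVecs d k ] collisions a′ (v′ , y′) (v , y)
        ≤⟨ ∑-mono-≤ (allVecs d k) (λ v → ∑≤-atMostOne (allVecs d k) (λ y → collisions a′ (v′ , y′) (v , y)) 1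
             (allVecs-unique d k) (same-y v) (λ y → collisions≤1 a′ (v′ , y′) (v , y))) ⟩
      ∑[ v ∈ allVecs d k ] 1
        ≡⟨ ∑-allVecs-const d k 1 ⟩
      d ^ k * 1 ∎
      where
      open ≤-Reasoning
      same-y : ∀ v y₁ y₂ → collisions a′ (v′ , y′) (v , y₁) ≢ 0 → collisions a′ (v′ , y′) (v , y₂) ≢ 0 → y₁ ≡ y₂
      same-y v y₁ y₂ c₁≢0 c₂≢0 =
        trans (proj₁ (collisions≢0 a′ (v′ , y′) (v , y₁) c₁≢0)) (sym (proj₁ (collisions≢0 a′ (v′ , y′) (v , y₂) c₂≢0)))

    collisions-row : ∀ a′ → ∑[ b′ ∈ P ] ∑[ b ∈ P ] collisions a′ b′ b ≤ (d ^ k) ^ 2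
    collisions-row a′ = begin
      ∑[ b′ ∈ P ] ∑[ b ∈ P ] collisions a′ b′ b
        ≡⟨ ∑-P (λ b′ → ∑[ b ∈ P ] collisions a′ b′ b) ⟩
      ∑[ v′ ∈ allVecs d k ] ∑[ y′ ∈ allVecs d k ] column a′ v′ y′
        ≤⟨ ∑-mono-≤ (allVecs d k) (λ v′ → ∑≤-atMostOne (allVecs d k) (column a′ v′) (d ^ k * 1)
             (allVecs-unique d k) (same-y′ v′) (column≤ a′ v′)) ⟩
      ∑[ v′ ∈ allVecs d k ] (d ^ k * 1)
        ≡⟨ ∑-allVecs-const d k (d ^ k * 1) ⟩
      (d ^ k) ^ 2 ∎
      where
      open ≤-Reasoning
      same-y′ : ∀ v′ y₁ y₂ → column a′ v′ y₁ ≢ 0 → column a′ v′ y₂ ≢ 0 → y₁ ≡ y₂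
      same-y′ v′ y₁ y₂ c₁≢0 c₂≢0 = trans (column≢0 a′ v′ y₁ c₁≢0) (sym (column≢0 a′ v′ y₂ c₂≢0))

    pairSum-≤ : pairSum SA SA SC ≤ ∣ SA ∣ * ∣ SA ∣
    pairSum-≤ = begin
      pairSum SA SA SC
        ≡⟨ pairSum-SA-SC ⟩
      ∑[ a′ ∈ P ] ∑[ b′ ∈ P ] ∑[ a ∈ P ] ∑[ b ∈ P ] ∑[ c ∈ R ] (hits a′ b c * hits a b′ c)
        ≡⟨ ∑-cong P (λ a′ → ∑-cong P (λ b′ → reorder a′ b′)) ⟩
      ∑[ a′ ∈ P ] ∑[ b′ ∈ P ] ∑[ b ∈ P ] collisions a′ b′ b
        ≤⟨ ∑-mono-≤ P collisions-row ⟩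
      ∑[ _ ∈ P ] ((d ^ k) ^ 2)
        ≡⟨ ∑-P-const ((d ^ k) ^ 2) ⟩
      d ^ k * (d ^ k * (d ^ k) ^ 2)
        ≡⟨ *-assoc (d ^ k) (d ^ k) _ ⟨
      d ^ k * d ^ k * (d ^ k) ^ 2
        ≡⟨ cong (_* (d ^ k) ^ 2) (cong (d ^ k *_) (*-identityʳ (d ^ k))) ⟨
      (d ^ k) ^ 2 * (d ^ k) ^ 2
        ≡⟨ cong₂ _*_ card-SA card-SA ⟨
      ∣ SA ∣ * ∣ SA ∣ ∎
      where
      open ≤-Reasoning
      reorder : ∀ a′ b′ →
        ∑[ a ∈ P ] ∑[ b ∈ P ] ∑[ c ∈ R ] (hits a′ b c * hits a b′ c) ≡ ∑[ b ∈ P ] collisions a′ b′ b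
      reorder a′ b′ = trans (∑-comm P P (λ a b → ∑[ c ∈ R ] (hits a′ b c * hits a b′ c)))
        (∑-cong P (λ b → ∑-comm P R (λ a c → hits a′ b c * hits a b′ c)))

    SA-nonempty : Nonempty SA
    SA-nonempty = subsetOf-nonempty (∈-map⁺ embedA (∈-cartesianProduct⁺ (∈-allVecs 𝟎) (∈-allVecs 𝟎)))
      where
      𝟎 : V
      𝟎 = replicate k fzero

    SC-nonempty : Nonempty SC
    SC-nonempty = subsetOf-nonempty (∈-map⁺ embedC (∈-cartesianProduct⁺ (∈-allVecs 𝟎) (∈-allVecs 𝟎)))
      where
      𝟎 : ∀ {e} → Vec (Fin (suc e)) k
      𝟎 = replicate k fzero

  construction : ∀ d .{{_ : NonZero d}} k m → minModulus d k ≤ suc m → GoodTriple m ((d ^ k) ^ 3 ≤_)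
  construction d k m = subst (λ d → minModulus d k ≤ suc m → GoodTriple m ((d ^ k) ^ 3 ≤_)) (suc-pred d)
    (λ n-large → let open Encoding (pred d) k m n-large in
      SA , SA , SC , SA-nonempty , SA-nonempty , SC-nonempty , pairSum-≤ , triangles-≥)

module Asymptotics where

  open Construction using (minModulus)
  open import Data.Nat
  open import Data.Nat.Properties
  open import Data.Nat.Tactic.RingSolver using (solve-∀)
  open import Data.Product using (_,_)
  open import Relation.Binary.PropositionalEquality

  2^-+ : ∀ a b → 2 ^ a * 2 ^ b ≡ 2 ^ (a + b)
  2^-+ a b = sym (^-distribˡ-+-* 2 a b)

  5[1+k]≤2^[k+3] : ∀ k → 5 * suc k ≤ 2 ^ (k + 3)
  5[1+k]≤2^[k+3] zero    = s≤s (s≤s (s≤s (s≤s (s≤s z≤n))))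
  5[1+k]≤2^[k+3] (suc k) = begin
    5 * suc (suc k)             ≡⟨ *-suc 5 (suc k) ⟩
    5 + 5 * suc k               ≤⟨ +-mono-≤ 5≤2^[k+3] (5[1+k]≤2^[k+3] k) ⟩
    2 ^ (k + 3) + 2 ^ (k + 3)   ≡⟨ cong (2 ^ (k + 3) +_) (+-identityʳ _) ⟨
    2 ^ (suc k + 3)             ∎
    where
    open ≤-Reasoning
    5≤2^[k+3] : 5 ≤ 2 ^ (k + 3)
    5≤2^[k+3] = ≤-trans (s≤s (s≤s (s≤s (s≤s (s≤s z≤n))))) (^-monoʳ-≤ 2 (m≤n+m 3 k))

  3+2Q≤5Q : ∀ {Q} → 0 < Q → suc (suc Q + suc Q) ≤ 5 * Q
  3+2Q≤5Q {suc q} _ = ≤-trans (m≤m+n _ (3 * q)) (≤-reflexive (identity q))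
    where
    identity : ∀ q → suc (suc (suc q) + suc (suc q)) + 3 * q ≡ 5 * suc q
    identity = solve-∀

  modulusExponent : ℕ → ℕ → ℕ
  modulusExponent s k = (k + 3) + (s + s) + suc s * suc k + suc s * suc k

  minModulus-2^ : ∀ s k → minModulus (2 ^ s) (suc k) ≤ 2 ^ modulusExponent s k
  minModulus-2^ s k = begin
    suc (suc Q + suc Q) * (2 ^ s + 2 ^ s) ^ suc k * (2 ^ s + 2 ^ s) ^ suc k
      ≡⟨ cong (λ B → suc (suc Q + suc Q) * B * B) base≡ ⟩
    suc (suc Q + suc Q) * 2 ^ (suc s * suc k) * 2 ^ (suc s * suc k)
      ≤⟨ *-monoˡ-≤ _ (*-monoˡ-≤ _ top≤) ⟩
    2 ^ ((k + 3) + (s + s)) * 2 ^ (suc s * suc k) * 2 ^ (suc s * suc k)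
      ≡⟨ cong (_* 2 ^ (suc s * suc k)) (2^-+ ((k + 3) + (s + s)) (suc s * suc k)) ⟩
    2 ^ ((k + 3) + (s + s) + suc s * suc k) * 2 ^ (suc s * suc k)
      ≡⟨ 2^-+ ((k + 3) + (s + s) + suc s * suc k) (suc s * suc k) ⟩
    2 ^ modulusExponent s k ∎
    where
    open ≤-Reasoning
    Q : ℕ
    Q = suc k * (2 ^ s * 2 ^ s)
    base≡ : (2 ^ s + 2 ^ s) ^ suc k ≡ 2 ^ (suc s * suc k)
    base≡ = trans (cong (λ x → (2 ^ s + x) ^ suc k) (sym (+-identityʳ _))) (^-*-assoc 2 (suc s) (suc k))
    top≤ : suc (suc Q + suc Q) ≤ 2 ^ ((k + 3) + (s + s))
    top≤ = begin
      suc (suc Q + suc Q)          ≤⟨ 3+2Q≤5Q 0<Q ⟩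
      5 * Q                        ≡⟨ *-assoc 5 (suc k) _ ⟨
      5 * suc k * (2 ^ s * 2 ^ s)  ≤⟨ *-mono-≤ (5[1+k]≤2^[k+3] k) (≤-reflexive (2^-+ s s)) ⟩
      2 ^ (k + 3) * 2 ^ (s + s)    ≡⟨ 2^-+ (k + 3) (s + s) ⟩
      2 ^ ((k + 3) + (s + s))      ∎
      where
      0<Q : 0 < Q
      0<Q = *-mono-≤ (s≤s (z≤n {k})) (<-≤-trans (m^n>0 2 (s + s)) (≤-reflexive (sym (2^-+ s s))))

  exponent-≤ : ∀ t k → 12 * t + 12 ≤ k →
    modulusExponent (3 * t + 3) k * (3 * t + 1) ≤ (3 * t + 3) * k * 3 * (2 * suc t)
  exponent-≤ t k k≥ with r , refl ← m≤n⇒∃[o]m+o≡n k≥ =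
    ≤-trans (m≤m+n _ _) (≤-reflexive (identity t r))
    where
    identity : ∀ t r →
      ((12 * t + 12 + r + 3) + ((3 * t + 3) + (3 * t + 3))
         + suc (3 * t + 3) * suc (12 * t + 12 + r) + suc (3 * t + 3) * suc (12 * t + 12 + r))
        * (3 * t + 1) + ((3 * t + 9) * r + 81 * t + 91)
      ≡ (3 * t + 3) * (12 * t + 12 + r) * 3 * (2 * suc t)
    identity = solve-∀

  below-minModulus : ∀ t k n → 12 * t + 12 ≤ k → n < minModulus (2 ^ (3 * t + 3)) (suc k) →
    n ^ (3 * t + 1) ≤ (((2 ^ (3 * t + 3)) ^ k) ^ 3) ^ (2 * suc t)
  below-minModulus t k n k≥ n< = begin
    n ^ (3 * t + 1)                      ≤⟨ ^-monoˡ-≤ (3 * t + 1) (≤-trans (<⇒≤ n<) (minModulus-2^ s k)) ⟩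
    (2 ^ modulusExponent s k) ^ (3 * t + 1) ≡⟨ ^-*-assoc 2 (modulusExponent s k) (3 * t + 1) ⟩
    2 ^ (modulusExponent s k * (3 * t + 1)) ≤⟨ ^-monoʳ-≤ 2 (exponent-≤ t k k≥) ⟩
    2 ^ (s * k * 3 * (2 * suc t))        ≡⟨ ^-*-assoc 2 (s * k * 3) (2 * suc t) ⟨
    (2 ^ (s * k * 3)) ^ (2 * suc t)      ≡⟨ cong (_^ (2 * suc t)) (^-*-assoc 2 (s * k) 3) ⟨
    ((2 ^ (s * k)) ^ 3) ^ (2 * suc t)    ≡⟨ cong (λ x → (x ^ 3) ^ (2 * suc t)) (^-*-assoc 2 s k) ⟨
    (((2 ^ s) ^ k) ^ 3) ^ (2 * suc t)    ∎
    where
    open ≤-Reasoning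
    s : ℕ
    s = 3 * t + 3

  k<minModulus : ∀ d .{{_ : NonZero d}} k → k < minModulus d k
  k<minModulus d k = begin-strict
    k                                   ≤⟨ m≤m*n k (d * d) {{m*n≢0 d d}} ⟩
    k * (d * d)                         <⟨ s≤s (≤-trans (n≤1+n _) (m≤m+n _ _)) ⟩
    suc (suc Q + suc Q)                 ≤⟨ m≤m*n _ (B * B) {{m*n≢0 B B}} ⟩
    suc (suc Q + suc Q) * (B * B)       ≡⟨ *-assoc (suc (suc Q + suc Q)) B B ⟨
    minModulus d k                      ∎
    where
    open ≤-Reasoning
    Q B : ℕ
    Q = k * (d * d)
    B = (d + d) ^ k
    instance
      _ : NonZero B
      _ = m^n≢0 (d + d) k {{>-nonZero (≤-trans (>-nonZero⁻¹ d) (m≤m+n d d))}}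

  threshold : ℕ → ℕ
  threshold t = minModulus (2 ^ (3 * t + 3)) (12 * t + 12)

  t≤threshold : ∀ t → t ≤ threshold t
  t≤threshold t = <⇒≤ (begin-strict
    t                                            ≤⟨ m≤n*m t 12 ⟩
    12 * t                                       ≤⟨ m≤m+n (12 * t) 12 ⟩
    12 * t + 12                                  <⟨ k<minModulus (2 ^ (3 * t + 3)) {{m^n≢0 2 (3 * t + 3)}} (12 * t + 12) ⟩
    threshold t                                  ∎)
    where open ≤-Reasoning

module RationalExponents where

  open import Defs using (powLe)
  open import Data.Nat as ℕ using (ℕ; suc; zero; _^_; _≤_; z≤n; s≤s)
  import Data.Nat.Properties as ℕ
  open import Data.Nat.Tactic.RingSolver using (solve-∀)
  open import Data.Integer as ℤ using (+_; -[1+_]; +<+)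
  import Data.Integer.Properties as ℤ
  open import Data.Rational using (ℚ; mkℚ; ↥_; ↧_; ↧ₙ_; _/_; _-_; -_; toℚᵘ; 0ℚ; ∣_∣; *<*)
  import Data.Rational as ℚ
  open import Data.Rational.Properties
  open import Data.Rational.Unnormalised as ℚᵘ using (mkℚᵘ; *≡*)
  import Data.Rational.Unnormalised.Properties as ℚᵘ
  open import Relation.Binary.PropositionalEquality
  open import Relation.Nullary using (yes; no; contradiction)

  ^-cancelʳ-≤ : ∀ {a c} q .{{_ : ℕ.NonZero q}} → a ^ q ≤ c ^ q → a ≤ c
  ^-cancelʳ-≤ {a} {c} q aᵠ≤cᵠ with a ℕ.≤? c
  ... | yes a≤c = a≤c
  ... | no  a≰c = contradiction aᵠ≤cᵠ (ℕ.<⇒≱ (ℕ.^-monoˡ-< q (ℕ.≰⇒> a≰c)))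

  -- With e = a/b in lowest terms and a·q = p·b: (nᵃ)^q = (nᵖ)^b ≤ (Tᵠ)^b = (Tᵇ)^q.
  powLe-intro : ∀ n (e : ℚ) T p q .{{_ : ℕ.NonZero q}} →
    ↥ e ℤ.* + q ≡ + p ℤ.* ↧ e → n ^ p ≤ T ^ q → powLe n e T
  powLe-intro n (mkℚ (+ a) b-1 _) T p q cross nᵖ≤Tᵠ = ^-cancelʳ-≤ q (begin
    (n ^ a) ^ q          ≡⟨ ℕ.^-*-assoc n a q ⟩
    n ^ (a ℕ.* q)        ≡⟨ cong (n ^_) aq≡pb ⟩
    n ^ (p ℕ.* suc b-1)  ≡⟨ ℕ.^-*-assoc n p (suc b-1) ⟨
    (n ^ p) ^ suc b-1    ≤⟨ ℕ.^-monoˡ-≤ (suc b-1) nᵖ≤Tᵠ ⟩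
    (T ^ q) ^ suc b-1    ≡⟨ ℕ.^-*-assoc T q (suc b-1) ⟩
    T ^ (q ℕ.* suc b-1)  ≡⟨ cong (T ^_) (ℕ.*-comm q (suc b-1)) ⟩
    T ^ (suc b-1 ℕ.* q)  ≡⟨ ℕ.^-*-assoc T (suc b-1) q ⟨
    (T ^ suc b-1) ^ q    ∎)
    where
    open ℕ.≤-Reasoning
    aq≡pb : a ℕ.* q ≡ p ℕ.* suc b-1
    aq≡pb = ℤ.+-injective (trans (ℤ.pos-* a q) (trans cross (sym (ℤ.pos-* p (suc b-1)))))
  powLe-intro n (mkℚ -[1+ a ] b-1 _) T p (suc q) cross _ with () ← trans cross (sym (ℤ.pos-* p (suc b-1)))

  -- 3/2 − 1/(t+1) = (3t+1)/(2t+2), computed in unnormalised rationals.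
  3/2-1/[1+t]ᵘ : ℕ → ℚᵘ.ℚᵘ
  3/2-1/[1+t]ᵘ t = mkℚᵘ (+ 3) 1 ℚᵘ.+ ℚᵘ.- mkℚᵘ (+ 1) t

  toℚᵘ-3/2-1/[1+t] : ∀ t → toℚᵘ (+ 3 / 2 - + 1 / suc t) ℚᵘ.≃ 3/2-1/[1+t]ᵘ t
  toℚᵘ-3/2-1/[1+t] t = ℚᵘ.≃-trans (toℚᵘ-homo-+ (+ 3 / 2) (- (+ 1 / suc t)))
    (ℚᵘ.+-cong (toℚᵘ-fromℚᵘ (mkℚᵘ (+ 3) 1))
               (ℚᵘ.≃-trans (toℚᵘ-homo‿- (+ 1 / suc t)) (ℚᵘ.-‿cong (toℚᵘ-fromℚᵘ (mkℚᵘ (+ 1) t)))))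

  ↥-3/2-1/[1+t]ᵘ : ∀ t → ℚᵘ.↥ (3/2-1/[1+t]ᵘ t) ≡ + (3 ℕ.* t ℕ.+ 1)
  ↥-3/2-1/[1+t]ᵘ t = trans (ℤ.⊖-≥ (s≤s (ℕ.≤-trans (s≤s z≤n) (ℕ.m≤n+m (2 ℕ.* suc t) t))))
    (cong +_ (trans (cong (ℕ._∸ 2) (identity t)) (ℕ.m+n∸n≡m (3 ℕ.* t ℕ.+ 1) 2)))
    where
    identity : ∀ t → suc (t ℕ.+ 2 ℕ.* suc t) ≡ (3 ℕ.* t ℕ.+ 1) ℕ.+ 2
    identity = solve-∀

  3/2-1/[1+t]-cross : ∀ t → let e = + 3 / 2 - + 1 / suc t in
    ↥ e ℤ.* + (2 ℕ.* suc t) ≡ + (3 ℕ.* t ℕ.+ 1) ℤ.* ↧ e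
  3/2-1/[1+t]-cross t with *≡* cross ← toℚᵘ-3/2-1/[1+t] t = trans
    (cong (ℤ._* + (2 ℕ.* suc t)) (sym (↥ᵘ-toℚᵘ e)))
    (trans cross (cong₂ ℤ._*_ (↥-3/2-1/[1+t]ᵘ t) (↧ᵘ-toℚᵘ e)))
    where
    e : ℚ
    e = + 3 / 2 - + 1 / suc t

  powLe-3/2-1/[1+t] : ∀ n t T → n ^ (3 ℕ.* t ℕ.+ 1) ≤ T ^ (2 ℕ.* suc t) →
    powLe n (+ 3 / 2 - + 1 / suc t) T
  powLe-3/2-1/[1+t] n t T =
    powLe-intro n (+ 3 / 2 - + 1 / suc t) T (3 ℕ.* t ℕ.+ 1) (2 ℕ.* suc t) (3/2-1/[1+t]-cross t)

  powLe-0 : ∀ n T → 1 ≤ T → powLe n (+ 3 / 2 - + 3 / 2) T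
  powLe-0 n T 1≤T = ℕ.≤-trans 1≤T (ℕ.≤-reflexive (sym (ℕ.*-identityʳ T)))

  ∣1/[1+t]∣<ε : ∀ t (ε : ℚ) → 0ℚ ℚ.< ε → ↧ₙ ε ≤ t → ∣ + 1 / suc t ∣ ℚ.< ε
  ∣1/[1+t]∣<ε t ε@(mkℚ (+ suc a) b-1 _) 0<ε b≤t =
    subst (ℚ._< ε) (sym (0≤p⇒∣p∣≡p (nonNegative⁻¹ (+ 1 / suc t) {{normalize-nonNeg 1 (suc t)}})))
      (toℚᵘ-cancel-< (ℚᵘ.<-respˡ-≃ (ℚᵘ.≃-sym (toℚᵘ-fromℚᵘ (mkℚᵘ (+ 1) t))) 1/[1+t]<ε))
    where
    1/[1+t]<ε : mkℚᵘ (+ 1) t ℚᵘ.< toℚᵘ ε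
    1/[1+t]<ε = ℚᵘ.*<* (subst₂ ℤ._<_ (ℤ.pos-* 1 (suc b-1)) (ℤ.pos-* (suc a) (suc t))
      (+<+ (ℕ.≤-trans (s≤s (ℕ.≤-reflexive (ℕ.+-identityʳ (suc b-1))))
                      (ℕ.≤-trans (s≤s b≤t) (ℕ.m≤m+n (suc t) (a ℕ.* suc t))))))
  ∣1/[1+t]∣<ε t (mkℚ (+ zero) _ _) (*<* (+<+ ()))
  ∣1/[1+t]∣<ε t (mkℚ -[1+ _ ] _ _) (*<* ())

module Search where

  open import Data.Nat using (ℕ; zero; suc; _≤_; _<_; z≤n; s≤s⁻¹)
  open import Data.Nat.Properties
  open import Data.Sum using ([_,_])
  open import Relation.Nullary using (¬_; yes; no; contradiction)
  open import Relation.Unary using (Decidable)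
  open import Relation.Binary.PropositionalEquality using (refl)

  data Greatest (P : ℕ → Set) (b : ℕ) : Set where
    none  : (∀ {t} → t ≤ b → ¬ P t) → Greatest P b
    found : ∀ t → P t → t ≤ b → (∀ {s} → t < s → s ≤ b → ¬ P s) → Greatest P b

  greatest : ∀ {P : ℕ → Set} → Decidable P → ∀ b → Greatest P b
  greatest P? zero with P? zero
  ... | yes p  = found zero p z≤n (λ 0<s s≤0 → contradiction s≤0 (<⇒≱ 0<s))
  ... | no  ¬p = none (λ { z≤n → ¬p })
  greatest P? (suc b) with P? (suc b)
  ... | yes p  = found (suc b) p ≤-refl (λ b<s s≤b → contradiction s≤b (<⇒≱ b<s))
  ... | no  ¬p with greatest P? b
  ...   | none ¬P = none (λ t≤1+b →
    [ (λ t<1+b → ¬P (s≤s⁻¹ t<1+b)) , (λ { refl → ¬p }) ] (m≤n⇒m<n∨m≡n t≤1+b))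
  ...   | found t p t≤b max = found t p (m≤n⇒m≤1+n t≤b) (λ t<s s≤1+b →
    [ (λ s<1+b → max t<s (s≤s⁻¹ s<1+b)) , (λ { refl → ¬p }) ] (m≤n⇒m<n∨m≡n s≤1+b))

module Loss where

  open ListSubsets
  open Construction using (minModulus; GoodTriple; GoodTriple-map; construction)
  open Asymptotics
  open RationalExponents
  open Search
  open import Defs using (powLe; triangles; pairSum)
  open import Data.Nat hiding (_/_)
  open import Data.Nat.Properties
  open import Data.Fin using (Fin) renaming (zero to fzero)
  open import Data.Fin.Subset using (Subset; Nonempty; ∣_∣)
  open import Data.Integer using (+_)
  open import Data.Rational using (ℚ; 0ℚ; _/_; _-_)
  import Data.Rational as ℚ
  open import Data.List using (List; []; _∷_)
  open import Data.List.Relation.Unary.Any using (here)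
  open import Data.List.Relation.Unary.All using ([])
  open import Data.List.Relation.Unary.AllPairs using ([]; _∷_)
  open import Data.List.Relation.Unary.Unique.Propositional using (Unique)
  open import Data.Product using (∃; _,_)
  open import Relation.Nullary using (yes; no; contradiction)
  open import Relation.Binary.PropositionalEquality using (refl; sym; trans; cong₂)

  loss : ∀ {P b} → Greatest P b → ℚ
  loss (none _)        = + 3 / 2
  loss (found t _ _ _) = + 1 / suc t

  f : ℕ → ℚ
  f n = loss (greatest (λ t → threshold t ≤? n) n)

  f→0 : ∀ ε → 0ℚ ℚ.< ε → ∃ λ N → ∀ n → n ≥ N → ℚ.∣ f n ∣ ℚ.< ε
  f→0 ε 0<ε = threshold t₀ , λ n th≤n → loss<ε n (greatest (λ t → threshold t ≤? n) n) th≤n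
    where
    t₀ : ℕ
    t₀ = ℚ.↧ₙ ε
    loss<ε : ∀ n (g : Greatest (λ t → threshold t ≤ n) n) → threshold t₀ ≤ n → ℚ.∣ loss g ∣ ℚ.< ε
    loss<ε n (none ¬P)         th≤n = contradiction th≤n (¬P (≤-trans (t≤threshold t₀) th≤n))
    loss<ε n (found t _ _ max) th≤n =
      ∣1/[1+t]∣<ε t ε 0<ε (≮⇒≥ (λ t<t₀ → max t<t₀ (≤-trans (t≤threshold t₀) th≤n) th≤n))

  Witness : ℕ → ℚ → Set
  Witness m e = GoodTriple m (powLe (suc m) e)

  witness-singleton : ∀ m → Witness m (+ 3 / 2 - + 3 / 2)
  witness-singleton m =
    A , A , A , A-nonempty , A-nonempty , A-nonempty , pairs≤ , powLe-0 (suc m) (triangles A A A) 1≤triangles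
    where
    L : List (Fin (suc m))
    L = fzero ∷ []
    L-unique : Unique L
    L-unique = [] ∷ []
    A : Subset (suc m)
    A = subsetOf L
    A-nonempty : Nonempty A
    A-nonempty = subsetOf-nonempty {l = L} (here refl)
    1≤triangles : 1 ≤ triangles A A A
    1≤triangles = ≤-reflexive (sym (triangles-subsetOf {m} {L} {L} {L} L-unique L-unique L-unique))
    pairs≤ : pairSum A A A ≤ ∣ A ∣ * ∣ A ∣
    pairs≤ = ≤-reflexive (trans (pairSum-subsetOf {m} {L} {L} {L} L-unique L-unique L-unique)
      (sym (cong₂ _*_ (card-subsetOf {l = L} L-unique) (card-subsetOf {l = L} L-unique))))

  witness-threshold : ∀ m t → threshold t ≤ suc m → Witness m (+ 3 / 2 - + 1 / suc t)
  witness-threshold m t th≤n = from-k (greatest (λ k → minModulus d k ≤? n) n)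
    where
    n d : ℕ
    n = suc m
    d = 2 ^ (3 * t + 3)
    instance
      _ : NonZero d
      _ = m^n≢0 2 (3 * t + 3)
    k₀≤n : 12 * t + 12 ≤ n
    k₀≤n = <⇒≤ (<-≤-trans (k<minModulus d (12 * t + 12)) th≤n)
    from-k : Greatest (λ k → minModulus d k ≤ n) n → Witness m (+ 3 / 2 - + 1 / suc t)
    from-k (none ¬P) = contradiction th≤n (¬P k₀≤n)
    from-k (found k fits _ max) =
      GoodTriple-map (λ {T} cubes≤ → powLe-3/2-1/[1+t] n t T (n^≤ T cubes≤)) (construction d k m fits)
      where
      k₀≤k : 12 * t + 12 ≤ k
      k₀≤k = ≮⇒≥ (λ k<k₀ → max k<k₀ k₀≤n th≤n)
      n<next : n < minModulus d (suc k)
      n<next with suc k ≤? n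
      ... | yes 1+k≤n = ≰⇒> (max (n<1+n k) 1+k≤n)
      ... | no  1+k≰n = <-trans (≰⇒> 1+k≰n) (k<minModulus d (suc k))
      n^≤ : ∀ T → (d ^ k) ^ 3 ≤ T → n ^ (3 * t + 1) ≤ T ^ (2 * suc t)
      n^≤ T cubes≤ = ≤-trans (below-minModulus t k n k₀≤k n<next) (^-monoˡ-≤ (2 * suc t) cubes≤)

  witness : ∀ m (g : Greatest (λ t → threshold t ≤ suc m) (suc m)) → Witness m (+ 3 / 2 - loss g)
  witness m (none _)           = witness-singleton m
  witness m (found t th≤n _ _) = witness-threshold m t th≤n

open import Defs
open import Data.Nat using (ℕ; suc; _*_; _≤_; _≥_; _≤?_)
open import Data.Fin.Subset using (Subset; Nonempty; ∣_∣)
open import Data.Integer using (+_)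
open import Data.Rational using (ℚ; 0ℚ; _/_; _-_; _<_; ∣_∣)
open import Data.Product using (Σ; ∃; _×_; _,_)
open Search using (greatest)
open Asymptotics using (threshold)
open Loss using (f; f→0; witness)

proposition4p8 :
    Σ (ℕ → ℚ) λ f →
      ((ε : ℚ) → 0ℚ < ε → ∃ λ N → (n : ℕ) → n ≥ N → Data.Rational.∣ f n ∣ < ε)
      × ((m : ℕ) → Σ (Subset (suc m)) λ A → Σ (Subset (suc m)) λ B → Σ (Subset (suc m)) λ C →
           Nonempty A × Nonempty B × Nonempty C
           × pairSum A B C ≤ Data.Fin.Subset.∣ A ∣ * Data.Fin.Subset.∣ B ∣
           × powLe (suc m) (((+ 3) / 2) - f (suc m)) (triangles A B C))
proposition4p8 = f , f→0 , λ m → witness m (greatest (λ t → threshold t ≤? suc m) (suc m))
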